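{- Let $\mathbf{k}$ be a commutative ring, $n\ge1$, and let $\beta=(\beta_1,\dots,\beta_p)$ and $\gamma=(\gamma_1,\dots,\gamma_p)$ be two compositions of $n$ of the same length $p$. Then in $F_{n,n}$, \[\mathbf{V}_\beta\,\mathbf{B}_\gamma=\sum_{\substack{\chi\in S_p;\\ \beta_{\chi(i)}=\gamma_i\text{ for each }i}}V^{\operatorname{Set}(\beta)_{\chi(1)}}V^{\operatorname{Set}(\beta)_{\chi(2)}}\cdots V^{\operatorname{Set}(\beta)_{\chi(p)}}.\]
   Context: $F_n$ is the free associative $\mathbf{k}$-algebra on noncommuting letters $\underline1,\dots,\underline n$; its degree-$n$ component $F_{n,n}$ has basis the words of length $n$. $S_n$ acts on $F_{n,n}$ from the right by $(\underline{w_1}\cdots\underline{w_n})\cdot\sigma=\underline{w_{\sigma(1)}}\cdots\underline{w_{\sigma(n)}}$, extended linearly to a right $\mathbf{k}[S_n]$-action. $[a,b]=ab-ba$. For nonempty $S\subseteq[n]$ with elements $s_1<\dots<s_k$, $V^S=[[\cdots[[\underline{s_1},\underline{s_2}],\underline{s_3}],\dots],\underline{s_k}]$. For a composition $\alpha=(\alpha_1,\dots,\alpha_p)$ of $n$ (positive integers summing to $n$), let $\alpha_{\le i}=\alpha_1+\cdots+\alpha_i$ and define the blocks $\operatorname{Set}(\alpha)_i=\{\alpha_{\le i-1}+1,\dots,\alpha_{\le i}\}$ for $i\in[p]$; set $\mathbf{V}_\alpha=V^{\operatorname{Set}(\alpha)_1}\cdots V^{\operatorname{Set}(\alpha)_p}$.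 $\operatorname{Des}(w)=\{i\in[n-1]\mid w(i)>w(i+1)\}$, and $\mathbf{B}_\alpha=\sum_{w\in S_n,\ \operatorname{Des}(w)\subseteq\{\alpha_{\le1},\dots,\alpha_{\le p-1}\}}w\in\mathbf{k}[S_n]$. -}

module Defs where

open import Level using (Level)
open import Algebra.Bundles using (CommutativeRing)
open import Data.Bool using (Bool; true; false; _∧_; not; if_then_else_)
open import Data.Nat as ℕ using (ℕ; zero; suc; _≤_; _≡ᵇ_; _≤ᵇ_; _<ᵇ_)
open import Data.Fin as Fin using (Fin; toℕ)
open import Data.Product using (_×_; _,_; proj₁; proj₂)
open import Data.List as List using (List; []; _∷_; _++_; concatMap; filterᵇ; allFin; foldr; take)
open import Data.Bool.ListAction using (any; all)
import Data.Nat.ListAction as NL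
open import Data.Vec as Vec using (Vec)
import Data.Vec.Relation.Unary.All as VAll
open import Data.List.Properties using (≡-dec)
open import Relation.Nullary using (does; yes; no)
open import Relation.Binary.PropositionalEquality using (_≡_; sym)

allVecs : (m k : ℕ) → List (Vec (Fin m) k)
allVecs m zero    = Vec.[] ∷ []
allVecs m (suc k) = concatMap (λ i → List.map (i Vec.∷_) (allVecs m k)) (allFin m)

distinct : ∀ {m} → List (Fin m) → Bool
distinct []       = true
distinct (x ∷ xs) = not (any (λ y → toℕ x ≡ᵇ toℕ y) xs) ∧ distinct xs

-- All permutations in S_m, in one-line notation w = (w(1),…,w(m))
-- (0-based letters/positions).
perms : (m : ℕ) → List (Vec (Fin m) m)
perms m = filterᵇ (λ v → distinct (Vec.toList v)) (allVecs m m)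

IsComposition : (n : ℕ) → ∀ {p} → Vec ℕ p → Set
IsComposition n α = VAll.All (λ a → 1 ≤ a) α × Vec.sum α ≡ n

psum : ∀ {p} → Vec ℕ p → ℕ → ℕ
psum α i = NL.sum (take i (Vec.toList α))

partialSums : ∀ {p} → Vec ℕ p → List ℕ
partialSums {p} α = List.map (λ i → psum α (suc (toℕ i))) (allFin (p ℕ.∸ 1))

-- Set(α)_{i+1} for 0-based block index i : Fin p.  Letter j (1-based)
-- is represented by the element j-1 of Fin n, so the block
-- {α_{≤i}+1,…,α_{≤i+1}} becomes {j : Fin n | α_{≤i} ≤ toℕ j < α_{≤i+1}},
-- listed in increasing order.
block : ∀ {p} (n : ℕ) → Vec ℕ p → Fin p → List (Fin n)
block n α i =
  filterᵇ (λ j → (psum α (toℕ i) ≤ᵇ toℕ j) ∧ (toℕ j <ᵇ psum α (suc (toℕ i))))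
          (allFin n)

-- Des(w) ⊆ S, where w is in one-line notation; k is the (1-based)
-- position of the first entry of the list.
desIn : ∀ {m} → List ℕ → ℕ → List (Fin m) → Bool
desIn S k []           = true
desIn S k (a ∷ [])     = true
desIn S k (a ∷ b ∷ xs) =
  (if toℕ b <ᵇ toℕ a then any (λ s → s ≡ᵇ k) S else true) ∧ desIn S (suc k) (b ∷ xs)

-- The free algebra F_n over a commutative ring, as finite formal
-- k-linear combinations of words in the letters Fin n.

module FreeAlg {c ℓ : Level} (R : CommutativeRing c ℓ) (n : ℕ) where
  open CommutativeRing R using (Carrier; _≈_; _+_; _*_; -_; 0#; 1#)

  Word : Set
  Word = List (Fin n)

  Poly : Set c
  Poly = List (Carrier × Word)

  0P : Poly
  0P = []

  1P : Poly
  1P = (1# , []) ∷ []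

  letter : Fin n → Poly
  letter i = (1# , i ∷ []) ∷ []

  _⊕_ : Poly → Poly → Poly
  _⊕_ = _++_

  ⊖_ : Poly → Poly
  ⊖_ = List.map (λ t → (- proj₁ t , proj₂ t))

  _⊗_ : Poly → Poly → Poly
  a ⊗ b = concatMap (λ s → List.map (λ t → (proj₁ s * proj₁ t , proj₂ s ++ proj₂ t)) b) a

  ΣP : List Poly → Poly
  ΣP = foldr _⊕_ 0P

  ΠP : List Poly → Poly
  ΠP = foldr _⊗_ 1P

  ⟦_,_⟧ : Poly → Poly → Poly
  ⟦ a , b ⟧ = (a ⊗ b) ⊕ (⊖ (b ⊗ a))

  -- V^S for S = s₁ < … < s_k (given as an increasing list):
  -- [[⋯[[s₁,s₂],s₃],…],s_k].  (Only used for nonempty S.)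
  V : List (Fin n) → Poly
  V []       = 0P
  V (s ∷ ss) = List.foldl (λ acc t → ⟦ acc , letter t ⟧) (letter s) ss

  coeff : Word → Poly → Carrier
  coeff w []            = 0#
  coeff w ((a , u) ∷ f) with ≡-dec Fin._≟_ u w
  ... | yes _ = a + coeff w f
  ... | no  _ = coeff w f

  -- equality in F_{n,n}: equal coefficients of all words of length n
  _≈ₙ_ : Poly → Poly → Set ℓ
  f ≈ₙ g = ∀ (w : Vec (Fin n) n) → coeff (Vec.toList w) f ≈ coeff (Vec.toList w) g

  -- right action of σ ∈ S_n (one-line notation) on a word of length n:
  -- (u₁⋯u_n)·σ = u_{σ(1)}⋯u_{σ(n)}.  (Words of other lengths never occur.)
  actWord : Vec (Fin n) n → Word → Word
  actWord σ u with List.length u ℕ.≟ n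
  ... | yes eq = Vec.toList (Vec.map (λ i → List.lookup u (Fin.cast (sym eq) i)) σ)
  ... | no  _  = u

  act : Poly → Vec (Fin n) n → Poly
  act f σ = List.map (λ t → (proj₁ t , actWord σ (proj₂ t))) f

  actSum : Poly → List (Vec (Fin n) n) → Poly
  actSum f L = ΣP (List.map (act f) L)

  Bperms : ∀ {p} → Vec ℕ p → List (Vec (Fin n) n)
  Bperms α = filterᵇ (λ w → desIn (partialSums α) 1 (Vec.toList w)) (perms n)

  𝐕 : ∀ {p} → Vec ℕ p → Poly
  𝐕 {p} α = ΠP (List.map (λ i → V (block n α i)) (allFin p))

  rhs : ∀ {p} → Vec ℕ p → Vec ℕ p → Poly
  rhs {p} β γ =
    ΣP (List.map (λ χ → ΠP (List.map (λ i → V (block n β (Vec.lookup χ i))) (allFin p)))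
                 (filterᵇ (λ χ → all (λ i → Vec.lookup β (Vec.lookup χ i) ≡ᵇ Vec.lookup γ i) (allFin p))
                          (perms p)))

{-# OPTIONS --safe #-}
-- Pair both sides with an arbitrary functional h on words (coefficients are the case h = δ_w).
-- For a word u of length n, the permutations w with descents only at the partial sums of γ
-- correspond to the maps g : [n] → [p] with fibre sizes γ (w lists the fibres of g one after
-- the other), and u · w is the concatenation of the subwords of u along these fibres.  Hence
-- ⟨𝐕_β B_γ, h⟩ is the pairing of the p-fold unshuffle coproduct Δ(𝐕_β) with the functional
-- "h of the concatenation, on tensors whose factors have lengths γ".  Δ is multiplicative and
-- each V^S, an iterated commutator of letters, is primitive, so Δ(𝐕_β) is a sum over maps
-- σ : [p] → [p] of tensors whose i-th factor is the product of the V^{Set(β)_j} with σ(j) = i.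
-- Only tensors with factor lengths γ survive; since every γ_i > 0, σ must then be a
-- permutation with β_{σ⁻¹(i)} = γ_i, and χ = σ⁻¹ gives the right-hand side.
module Submission where

open import Defs
open import Level using (Level; _⊔_)
open import Algebra.Bundles using (CommutativeRing)
open import Data.Nat using (ℕ; _≤_)
open import Data.Vec using (Vec)

open import Data.Bool using (Bool; true; false; T; T?; not; _∧_; if_then_else_)
open import Data.Bool.Properties using (T-∧; T-≡)
open import Data.Bool.ListAction using (any; all)
open import Data.Empty using (⊥-elim)
open import Data.Fin as Fin using (Fin; zero; suc; toℕ)
import Data.Fin.Properties as Fin
open import Data.List as List using (List; []; _∷_; _++_; take; drop; length; concatMap; filter; filterᵇ; allFin; foldr)
import Data.List.Properties as List
open import Data.List.Membership.Propositional using (_∈_; _∉_)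
import Data.List.Membership.Propositional.Properties as ∈
import Data.List.Membership.DecPropositional as DecMembership
open import Data.List.Relation.Unary.All as All using (All; []; _∷_)
import Data.List.Relation.Unary.All.Properties as All
open import Data.List.Relation.Unary.Any as Any using (here; there)
import Data.List.Relation.Unary.Any.Properties as Any
open import Data.List.Relation.Unary.Linked as Linked using (Linked; []; [-]; _∷_)
import Data.List.Relation.Unary.Linked.Properties as Linked
open import Data.Nat as ℕ using (zero; suc; _∸_; _<_; z≤n; s≤s; _≤ᵇ_; _<ᵇ_)
import Data.Nat.Properties as ℕ
open import Data.Product using (_×_; _,_; proj₁; proj₂; ∃)
open import Data.Product.Function.NonDependent.Propositional using (_×-⇔_)
open import Data.Sum using (inj₁; inj₂)
open import Data.Unit using (⊤)
open import Data.Vec as Vec using ([]; _∷_; lookup; toList; tabulate)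
import Data.Vec.Properties as Vec
import Data.Vec.Membership.Propositional.Properties as ∈ᵥ
open import Data.Vec.Relation.Unary.All as VAll using () renaming ([] to []ᵥ; _∷_ to _∷ᵥ_)
import Data.Vec.Relation.Unary.All.Properties as VAll
import Data.Vec.Relation.Unary.Any as AnyV
import Data.Vec.Relation.Unary.Any.Properties as AnyV
open import Function using (_∘_; id; _⇔_)
open import Function.Bundles using (Equivalence; mk⇔)
open import Function.Definitions using (Injective; StrictlySurjective)
import Function.Properties.Equivalence as ⇔
open import Relation.Binary.Definitions using (DecidableEquality)
open import Relation.Binary.PropositionalEquality as ≡ using (_≡_; _≢_; refl; cong; cong₂; subst)
open import Relation.Nullary using (¬_; Dec; yes; no; does; isYes)
open import Relation.Nullary.Decidable using (dec-true; dec-false; toWitness; fromWitness)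
open import Relation.Nullary.Negation using (contradiction)
open import Relation.Unary using (Pred; Decidable)

open Equivalence using (to; from)

private
  variable
    a b : Level
    A : Set a
    B : Set b
    k m p q : ℕ
    Cut : ℕ → Set

module FiniteSums {c ℓ : Level} (R : CommutativeRing c ℓ) where
  open CommutativeRing R renaming (refl to ≈-refl) hiding (zero)
  open import Algebra.Properties.Ring ring using (-‿+-comm; -0#≈0#)
  open import Algebra.Properties.CommutativeSemigroup +-commutativeSemigroup
    using () renaming (interchange to +-interchange)
  open import Relation.Binary.Reasoning.Setoid setoid

  ∑ : List A → (A → Carrier) → Carrier
  ∑ []       f = 0#
  ∑ (x ∷ xs) f = f x + ∑ xs f

  infix 6 ∑
  syntax ∑ xs (λ x → e) = ∑[ x ← xs ] e

  infixr 7 [_]·_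
  [_]·_ : Bool → Carrier → Carrier
  [ b ]· x = if b then x else 0#

  []·-∧ : ∀ a b x → [ a ]· [ b ]· x ≡ [ a ∧ b ]· x
  []·-∧ true  b x = refl
  []·-∧ false b x = refl

  []·-cong : ∀ b {x y} → x ≈ y → [ b ]· x ≈ [ b ]· y
  []·-cong true  x≈y = x≈y
  []·-cong false _   = ≈-refl

  ∑-cong : ∀ xs {f g : A → Carrier} → (∀ x → f x ≈ g x) → ∑ xs f ≈ ∑ xs g
  ∑-cong []       f≈g = ≈-refl
  ∑-cong (x ∷ xs) f≈g = +-cong (f≈g x) (∑-cong xs f≈g)

  ∑-zero : ∀ xs {f : A → Carrier} → (∀ x → f x ≈ 0#) → ∑ xs f ≈ 0#
  ∑-zero []       f≈0 = ≈-refl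
  ∑-zero (x ∷ xs) f≈0 = trans (+-cong (f≈0 x) (∑-zero xs f≈0)) (+-identityˡ 0#)

  ∑-++ : ∀ xs ys (f : A → Carrier) → ∑ (xs ++ ys) f ≈ ∑ xs f + ∑ ys f
  ∑-++ []       ys f = sym (+-identityˡ _)
  ∑-++ (x ∷ xs) ys f = trans (+-congˡ (∑-++ xs ys f)) (sym (+-assoc _ _ _))

  ∑-+ : ∀ xs (f g : A → Carrier) → ∑[ x ← xs ] (f x + g x) ≈ ∑ xs f + ∑ xs g
  ∑-+ []       f g = sym (+-identityˡ 0#)
  ∑-+ (x ∷ xs) f g = trans (+-congˡ (∑-+ xs f g)) (+-interchange (f x) (g x) _ _)

  *-distribˡ-∑ : ∀ a xs (f : A → Carrier) → a * ∑ xs f ≈ ∑[ x ← xs ] (a * f x)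
  *-distribˡ-∑ a []       f = zeroʳ a
  *-distribˡ-∑ a (x ∷ xs) f = trans (distribˡ a _ _) (+-congˡ (*-distribˡ-∑ a xs f))

  -‿∑ : ∀ xs (f : A → Carrier) → - ∑ xs f ≈ ∑[ x ← xs ] (- f x)
  -‿∑ []       f = -0#≈0#
  -‿∑ (x ∷ xs) f = trans (sym (-‿+-comm _ _)) (+-congˡ (-‿∑ xs f))

  ∑-filterᵇ : ∀ (P : A → Bool) xs (f : A → Carrier) →
              ∑ (filterᵇ P xs) f ≈ ∑[ x ← xs ] [ P x ]· f x
  ∑-filterᵇ P []       f = ≈-refl
  ∑-filterᵇ P (x ∷ xs) f with P x
  ... | true  = +-congˡ (∑-filterᵇ P xs f)
  ... | false = trans (∑-filterᵇ P xs f) (sym (+-identityˡ _))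

  ∑-map : ∀ (g : A → B) xs (f : B → Carrier) →
          ∑ (List.map g xs) f ≡ ∑ xs (f ∘ g)
  ∑-map g []       f = refl
  ∑-map g (x ∷ xs) f = cong (f (g x) +_) (∑-map g xs f)

  ∑-concatMap : ∀ (g : A → List B) xs (f : B → Carrier) →
                ∑ (concatMap g xs) f ≈ ∑[ x ← xs ] ∑ (g x) f
  ∑-concatMap g []       f = ≈-refl
  ∑-concatMap g (x ∷ xs) f = trans (∑-++ (g x) _ f) (+-congˡ (∑-concatMap g xs f))

  ∑-comm : ∀ (xs : List A) (ys : List B) (f : A → B → Carrier) →
           ∑[ x ← xs ] ∑[ y ← ys ] f x y ≈ ∑[ y ← ys ] ∑[ x ← xs ] f x y
  ∑-comm []       ys f = sym (∑-zero ys (λ _ → ≈-refl))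
  ∑-comm (x ∷ xs) ys f = trans (+-congˡ (∑-comm xs ys f)) (sym (∑-+ ys (f x) _))

  ∑-allFin-suc : ∀ {p} (f : Fin (suc p) → Carrier) → ∑ (allFin (suc p)) f ≡ f zero + ∑ (allFin p) (f ∘ suc)
  ∑-allFin-suc {p} f = cong (f zero +_) (≡.trans (cong (λ js → ∑ js f) (≡.sym (List.map-tabulate id suc)))
                                                 (∑-map suc (allFin p) f))

  ∑-allFin-single : ∀ {p} (f : Fin p → Carrier) i → (∀ j → j ≢ i → f j ≈ 0#) → ∑ (allFin p) f ≈ f i
  ∑-allFin-single {suc p} f zero    f≈0 = begin
    ∑ (allFin (suc p)) f                    ≡⟨ ∑-allFin-suc f ⟩
    f zero + ∑ (allFin p) (f ∘ suc)         ≈⟨ +-congˡ (∑-zero (allFin p) (λ j → f≈0 (suc j) λ ())) ⟩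
    f zero + 0#                             ≈⟨ +-identityʳ _ ⟩
    f zero                                  ∎
  ∑-allFin-single {suc p} f (suc i) f≈0 = begin
    ∑ (allFin (suc p)) f                    ≡⟨ ∑-allFin-suc f ⟩
    f zero + ∑ (allFin p) (f ∘ suc)         ≈⟨ +-cong (f≈0 zero λ ()) (∑-allFin-single (f ∘ suc) i f∘suc≈0) ⟩
    0# + f (suc i)                          ≈⟨ +-identityˡ _ ⟩
    f (suc i)                               ∎
    where
    f∘suc≈0 : ∀ j → j ≢ i → f (suc j) ≈ 0#
    f∘suc≈0 j j≢i = f≈0 (suc j) (j≢i ∘ Fin.suc-injective)

  record Enumerates {a} {A : Set a} (_≟_ : DecidableEquality A) (xs : List A) : Set (a ⊔ c ⊔ ℓ) where
    field sift : ∀ (f : A → Carrier) y → ∑[ x ← xs ] [ does (x ≟ y) ]· f x ≈ f y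

  open Enumerates

  module _ {_≟ᴬ_ : DecidableEquality A} {_≟ᴮ_ : DecidableEquality B}
           {xs : List A} {ys : List B} (xs-enum : Enumerates _≟ᴬ_ xs) (ys-enum : Enumerates _≟ᴮ_ ys)
           {P : A → Bool} {Q : B → Bool} (φ : A → B) (ψ : B → A)
           (φ-P→Q : ∀ {x} → T (P x) → T (Q (φ x))) (ψ-Q→P : ∀ {y} → T (Q y) → T (P (ψ y)))
           (ψ∘φ : ∀ {x} → T (P x) → ψ (φ x) ≡ x) (φ∘ψ : ∀ {y} → T (Q y) → φ (ψ y) ≡ y) where

    ∑-reindex : ∀ (f : A → Carrier) (g : B → Carrier) → (∀ {x} → T (P x) → f x ≈ g (φ x)) →
                ∑[ x ← xs ] [ P x ]· f x ≈ ∑[ y ← ys ] [ Q y ]· g y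
    ∑-reindex f g f≈g∘φ = begin
      ∑[ x ← xs ] [ P x ]· f x                                    ≈⟨ ∑-cong xs spread ⟩
      ∑[ x ← xs ] ∑[ y ← ys ] [ P x ∧ does (y ≟ᴮ φ x) ]· g y      ≈⟨ ∑-comm xs ys _ ⟩
      ∑[ y ← ys ] ∑[ x ← xs ] [ P x ∧ does (y ≟ᴮ φ x) ]· g y      ≈⟨ ∑-cong ys collect ⟩
      ∑[ y ← ys ] [ Q y ]· g y                                    ∎
      where
      spread : ∀ x → [ P x ]· f x ≈ ∑[ y ← ys ] [ P x ∧ does (y ≟ᴮ φ x) ]· g y
      spread x with P x in Px
      ... | true  = trans (f≈g∘φ (from T-≡ Px)) (sym (sift ys-enum g (φ x)))
      ... | false = sym (∑-zero ys (λ _ → ≈-refl))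

      indicator : ∀ y x → T (Q y) → P x ∧ does (y ≟ᴮ φ x) ≡ does (x ≟ᴬ ψ y)
      indicator y x Qy with x ≟ᴬ ψ y
      ... | yes refl = ≡.cong₂ _∧_ (to T-≡ (ψ-Q→P Qy)) (dec-true (y ≟ᴮ φ (ψ y)) (≡.sym (φ∘ψ Qy)))
      ... | no x≢ψy with P x in Px
      ...   | false = refl
      ...   | true  = dec-false (y ≟ᴮ φ x) (λ { refl → x≢ψy (≡.sym (ψ∘φ (from T-≡ Px))) })

      empty-fibre : ∀ y x → ¬ T (Q y) → [ P x ∧ does (y ≟ᴮ φ x) ]· g y ≈ 0#
      empty-fibre y x ¬Qy with P x in Px | y ≟ᴮ φ x
      ... | false | _        = ≈-refl
      ... | true  | no _     = ≈-refl
      ... | true  | yes refl = ⊥-elim (¬Qy (φ-P→Q (from T-≡ Px)))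

      collect : ∀ y → ∑[ x ← xs ] [ P x ∧ does (y ≟ᴮ φ x) ]· g y ≈ [ Q y ]· g y
      collect y with Q y in Qy
      ... | true  = trans (∑-cong xs (λ x → reflexive (cong ([_]· g y) (indicator y x (from T-≡ Qy)))))
                          (sift xs-enum (λ _ → g y) (ψ y))
      ... | false = ∑-zero xs (λ x → empty-fibre y x (λ Qy′ → ⊥-elim (subst T Qy Qy′)))

  allFin-enumerates : ∀ p → Enumerates Fin._≟_ (allFin p)
  sift (allFin-enumerates p) f y = trans
    (∑-allFin-single _ y (λ j j≢y → reflexive (cong ([_]· f j) (dec-false (j Fin.≟ y) j≢y))))
    (reflexive (cong ([_]· f y) (dec-true (y Fin.≟ y) refl)))

  ∑-allVecs-suc : ∀ m k (f : Vec (Fin m) (suc k) → Carrier) →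
                  ∑ (allVecs m (suc k)) f ≈ ∑[ i ← allFin m ] ∑[ v ← allVecs m k ] f (i ∷ v)
  ∑-allVecs-suc m k f =
    trans (∑-concatMap _ (allFin m) f) (∑-cong (allFin m) (λ i → reflexive (∑-map (i ∷_) (allVecs m k) f)))

  allVecs-enumerates : ∀ m k → Enumerates (Vec.≡-dec Fin._≟_) (allVecs m k)
  sift (allVecs-enumerates m zero)    f []       = +-identityʳ _
  sift (allVecs-enumerates m (suc k)) f (y ∷ ys) = begin
    ∑[ v ← allVecs m (suc k) ] [ does (Vec.≡-dec Fin._≟_ v (y ∷ ys)) ]· f v
      ≈⟨ ∑-allVecs-suc m k _ ⟩
    ∑[ i ← allFin m ] ∑[ v ← allVecs m k ] [ does (i Fin.≟ y) ∧ does (Vec.≡-dec Fin._≟_ v ys) ]· f (i ∷ v)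
      ≈⟨ ∑-cong (allFin m) tail ⟩
    ∑[ i ← allFin m ] [ does (i Fin.≟ y) ]· f (i ∷ ys)
      ≈⟨ sift (allFin-enumerates m) (λ i → f (i ∷ ys)) y ⟩
    f (y ∷ ys) ∎
    where
    tail : ∀ i → ∑[ v ← allVecs m k ] [ does (i Fin.≟ y) ∧ does (Vec.≡-dec Fin._≟_ v ys) ]· f (i ∷ v)
               ≈ [ does (i Fin.≟ y) ]· f (i ∷ ys)
    tail i with does (i Fin.≟ y)
    ... | true  = sift (allVecs-enumerates m k) (λ v → f (i ∷ v)) ys
    ... | false = ∑-zero (allVecs m k) (λ _ → ≈-refl)

  ∑-allVecs-+ : ∀ m k k′ (f : List (Fin m) → Carrier) →
                ∑[ v ← allVecs m (k ℕ.+ k′) ] f (toList v)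
                  ≈ ∑[ v ← allVecs m k ] ∑[ v′ ← allVecs m k′ ] f (toList v ++ toList v′)
  ∑-allVecs-+ m zero    k′ f = sym (+-identityʳ _)
  ∑-allVecs-+ m (suc k) k′ f = begin
    ∑[ v ← allVecs m (suc k ℕ.+ k′) ] f (toList v)
      ≈⟨ ∑-allVecs-suc m (k ℕ.+ k′) _ ⟩
    ∑[ i ← allFin m ] ∑[ v ← allVecs m (k ℕ.+ k′) ] f (i ∷ toList v)
      ≈⟨ ∑-cong (allFin m) (λ i → ∑-allVecs-+ m k k′ (f ∘ (i ∷_))) ⟩
    ∑[ i ← allFin m ] ∑[ v ← allVecs m k ] ∑[ v′ ← allVecs m k′ ] f (i ∷ toList v ++ toList v′)
      ≈⟨ ∑-allVecs-suc m k _ ⟨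
    ∑[ v ← allVecs m (suc k) ] ∑[ v′ ← allVecs m k′ ] f (toList v ++ toList v′) ∎

-- Maps between finite sets, as vectors

≗⇒≡ : {u v : Vec A k} → (∀ i → lookup u i ≡ lookup v i) → u ≡ v
≗⇒≡ {u = u} {v} u≗v = ≡.trans (≡.sym (Vec.tabulate∘lookup u))
                             (≡.trans (Vec.tabulate-cong u≗v) (Vec.tabulate∘lookup v))

findOr : Fin q → {P : Pred (Fin q) a} → Decidable P → Fin q
findOr d P? with Fin.any? P?
... | yes (i , _) = i
... | no  _       = d

findOr-unique : ∀ (d : Fin q) {P : Pred (Fin q) a} (P? : Decidable P) {i} →
                P i → (∀ {j} → P j → j ≡ i) → findOr d P? ≡ i
findOr-unique d P? Pi unique with Fin.any? P?
... | yes (j , Pj) = unique Pj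
... | no  ¬∃P      = contradiction (_ , Pi) ¬∃P

injective⇒surjective : {f : Fin q → Fin q} → Injective _≡_ _≡_ f → StrictlySurjective _≡_ f
injective⇒surjective {suc q} {f} f-inj k with Fin.any? (λ i → f i Fin.≟ k)
... | yes k∈im = k∈im
... | no  k∉im = contradiction (Fin.injective⇒≤ punchedOut-injective) ℕ.1+n≰n
  where
  k≢f : ∀ i → k ≢ f i
  k≢f i k≡fi = k∉im (i , ≡.sym k≡fi)
  punchedOut : Fin (suc q) → Fin q
  punchedOut i = Fin.punchOut (k≢f i)
  punchedOut-injective : Injective _≡_ _≡_ punchedOut
  punchedOut-injective {i} {j} = f-inj ∘ Fin.punchOut-injective (k≢f i) (k≢f j)

surjective⇒injective : {f : Fin q → Fin q} → StrictlySurjective _≡_ f → Injective _≡_ _≡_ f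
surjective⇒injective {f = f} f-surj {i} {j} fi≡fj = begin
  i                 ≡⟨ section∘f i ⟨
  section (f i)     ≡⟨ cong section fi≡fj ⟩
  section (f j)     ≡⟨ section∘f j ⟩
  j                 ∎
  where
  open ≡.≡-Reasoning
  section : Fin _ → Fin _
  section = proj₁ ∘ f-surj
  f∘section : ∀ k → f (section k) ≡ k
  f∘section = proj₂ ∘ f-surj
  -- The section of f is injective, hence onto, hence also a left inverse of f.
  section∘f : ∀ i → section (f i) ≡ i
  section-injective : Injective _≡_ _≡_ section
  section-injective eq = ≡.trans (≡.sym (f∘section _)) (≡.trans (cong f eq) (f∘section _))
  section∘f i with injective⇒surjective section-injective i
  ... | k , section-k≡i = ≡.trans (cong (section ∘ f) (≡.sym section-k≡i))
                                   (≡.trans (cong section (f∘section k)) section-k≡i)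

inverse : Vec (Fin q) q → Vec (Fin q) q
inverse f = tabulate λ j → findOr j (λ i → lookup f i Fin.≟ j)

module _ (f : Vec (Fin q) q) (f-inj : Injective _≡_ _≡_ (lookup f)) where

  lookup-inverse : ∀ {i j} → lookup f i ≡ j → lookup (inverse f) j ≡ i
  lookup-inverse {i} {j} fi≡j = ≡.trans (Vec.lookup∘tabulate _ j)
    (findOr-unique j (λ i → lookup f i Fin.≟ j) fi≡j (λ fi′≡j → f-inj (≡.trans fi′≡j (≡.sym fi≡j))))

  inverse∘f : ∀ i → lookup (inverse f) (lookup f i) ≡ i
  inverse∘f i = lookup-inverse refl

  f∘inverse : ∀ j → lookup f (lookup (inverse f) j) ≡ j
  f∘inverse j with injective⇒surjective f-inj j
  ... | i , fi≡j = ≡.trans (cong (lookup f) (lookup-inverse fi≡j)) fi≡j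

  inverse-injective : Injective _≡_ _≡_ (lookup (inverse f))
  inverse-injective {j} {j′} eq = ≡.trans (≡.sym (f∘inverse j)) (≡.trans (cong (lookup f) eq) (f∘inverse j′))

inverse-involutive : ∀ (f : Vec (Fin q) q) → Injective _≡_ _≡_ (lookup f) → inverse (inverse f) ≡ f
inverse-involutive f f-inj =
  ≗⇒≡ λ i → lookup-inverse (inverse f) (inverse-injective f f-inj) (inverse∘f f f-inj i)

T-not⇔¬T : ∀ {b} → T (not b) ⇔ (¬ T b)
T-not⇔¬T {true}  = mk⇔ (λ ()) (λ ¬T → ¬T _)
T-not⇔¬T {false} = mk⇔ (λ _ ()) _

module _ {x : Fin m} where

  ∈⇔occurs : ∀ {xs} → x ∈ xs ⇔ T (any (λ y → toℕ x ℕ.≡ᵇ toℕ y) xs)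
  ∈⇔occurs = mk⇔ (Any.any⁺ _ ∘ Any.map (λ { refl → ℕ.≡⇒≡ᵇ (toℕ x) (toℕ x) refl }))
                 (Any.map (Fin.toℕ-injective ∘ ℕ.≡ᵇ⇒≡ _ _) ∘ Any.any⁻ _ _)

distinct-∷ : ∀ (x : Fin m) xs → T (distinct (x ∷ xs)) ⇔ (x ∉ xs × T (distinct xs))
distinct-∷ x xs = mk⇔
  (λ d → let x∉ , d′ = to T-∧ d in (to T-not⇔¬T x∉ ∘ to ∈⇔occurs) , d′)
  (λ { (x∉ , d′) → from T-∧ (from T-not⇔¬T (x∉ ∘ from ∈⇔occurs) , d′) })

∈-toList⇒lookup : ∀ {x : A} (v : Vec A k) → x ∈ toList v → ∃ λ i → lookup v i ≡ x
∈-toList⇒lookup v x∈ = let x∈ᵥv = ∈ᵥ.∈-toList⁻ x∈ in AnyV.index x∈ᵥv , ≡.sym (AnyV.lookup-index x∈ᵥv)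

lookup∈toList : ∀ (v : Vec A k) i → lookup v i ∈ toList v
lookup∈toList v i = ∈ᵥ.∈-toList⁺ (∈ᵥ.∈-lookup i v)

distinct⇒injective : ∀ (v : Vec (Fin m) k) → T (distinct (toList v)) → Injective _≡_ _≡_ (lookup v)
distinct⇒injective (x ∷ v) d {zero}  {zero}  _     = refl
distinct⇒injective (x ∷ v) d {zero}  {suc j} x≡vj  =
  contradiction (subst (_∈ toList v) (≡.sym x≡vj) (lookup∈toList v j)) (proj₁ (to (distinct-∷ x (toList v)) d))
distinct⇒injective (x ∷ v) d {suc i} {zero}  vi≡x  =
  contradiction (subst (_∈ toList v) vi≡x (lookup∈toList v i)) (proj₁ (to (distinct-∷ x (toList v)) d))
distinct⇒injective (x ∷ v) d {suc i} {suc j} vi≡vj =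
  cong suc (distinct⇒injective v (proj₂ (to (distinct-∷ x (toList v)) d)) vi≡vj)

injective⇒distinct : ∀ (v : Vec (Fin m) k) → Injective _≡_ _≡_ (lookup v) → T (distinct (toList v))
injective⇒distinct []      _     = _
injective⇒distinct (x ∷ v) v-inj = from (distinct-∷ x (toList v)) (x∉v , injective⇒distinct v (Fin.suc-injective ∘ v-inj))
  where
  x∉v : x ∉ toList v
  x∉v x∈v = let j , vj≡x = ∈-toList⇒lookup v x∈v in Fin.0≢1+n (v-inj {zero} {suc j} (≡.sym vj≡x))

filter-map : ∀ {b c} {B : Set b} {P : Pred B c} (P? : Decidable P) (f : A → B) xs →
             filter P? (List.map f xs) ≡ List.map f (filter (P? ∘ f) xs)
filter-map P? f []       = refl
filter-map P? f (x ∷ xs) with does (P? (f x))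
... | true  = cong (f x ∷_) (filter-map P? f xs)
... | false = filter-map P? f xs

fibre : Vec (Fin p) q → Fin p → List (Fin q)
fibre {q = q} f i = filter (λ j → lookup f j Fin.≟ i) (allFin q)

module _ (f : Vec (Fin p) q) {i : Fin p} {j : Fin q} where

  ∈-fibre⁺ : lookup f j ≡ i → j ∈ fibre f i
  ∈-fibre⁺ = ∈.∈-filter⁺ (λ j → lookup f j Fin.≟ i) {xs = allFin q} (∈.∈-allFin j)

  ∈-fibre⁻ : j ∈ fibre f i → lookup f j ≡ i
  ∈-fibre⁻ = proj₂ ∘ ∈.∈-filter⁻ (λ j → lookup f j Fin.≟ i) {xs = allFin q}

module _ (f : Vec (Fin p) q) where

  fibre-suc : ∀ i₀ i → filter (λ j → lookup (i₀ ∷ f) j Fin.≟ i) (List.tabulate suc) ≡ List.map suc (fibre f i)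
  fibre-suc i₀ i = ≡.trans (cong (filter _) (≡.sym (List.map-tabulate id suc))) (filter-map _ suc (allFin q))

  fibre-∷-≡ : ∀ i → fibre (i ∷ f) i ≡ zero ∷ List.map suc (fibre f i)
  fibre-∷-≡ i = ≡.trans (List.filter-accept (λ j → lookup (i ∷ f) j Fin.≟ i) {x = zero} {xs = List.tabulate suc} refl)
                        (cong (zero ∷_) (fibre-suc i i))

  fibre-∷-≢ : ∀ {i₀ i} → i₀ ≢ i → fibre (i₀ ∷ f) i ≡ List.map suc (fibre f i)
  fibre-∷-≢ {i₀} {i} i₀≢i =
    ≡.trans (List.filter-reject (λ j → lookup (i₀ ∷ f) j Fin.≟ i) {x = zero} {xs = List.tabulate suc} i₀≢i)
            (fibre-suc i₀ i)

gather : (A → A → A) → A → Vec (Fin p) q → (Fin q → A) → Vec A p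
gather {p = p} _∙_ ε []      x = Vec.replicate p ε
gather         _∙_ ε (i ∷ f) x = Vec.updateAt (gather _∙_ ε f (x ∘ suc)) i (x zero ∙_)

lookup-gather : ∀ (_∙_ : A → A → A) ε (f : Vec (Fin p) q) x i →
                lookup (gather _∙_ ε f x) i ≡ foldr _∙_ ε (List.map x (fibre f i))
lookup-gather _∙_ ε []       x i = Vec.lookup-replicate i ε
lookup-gather {A = A} {p = p} _∙_ ε (i₀ ∷ f) x i = by-cases i₀ i (i₀ Fin.≟ i)
  where
  open ≡.≡-Reasoning
  G : Vec A p
  G = gather _∙_ ε f (x ∘ suc)
  lookup-G : ∀ i → lookup G i ≡ foldr _∙_ ε (List.map x (List.map suc (fibre f i)))
  lookup-G i = ≡.trans (lookup-gather _∙_ ε f (x ∘ suc) i) (cong (foldr _∙_ ε) (List.map-∘ (fibre f i)))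
  by-cases : ∀ i₀ i → Dec (i₀ ≡ i) →
             lookup (gather _∙_ ε (i₀ ∷ f) x) i ≡ foldr _∙_ ε (List.map x (fibre (i₀ ∷ f) i))
  by-cases i .i (yes refl) = begin
    lookup (Vec.updateAt G i (x zero ∙_)) i                      ≡⟨ Vec.lookup∘updateAt i G ⟩
    x zero ∙ lookup G i                                           ≡⟨ cong (x zero ∙_) (lookup-G i) ⟩
    x zero ∙ foldr _∙_ ε (List.map x (List.map suc (fibre f i)))  ≡⟨ cong (foldr _∙_ ε ∘ List.map x) (fibre-∷-≡ f i) ⟨
    foldr _∙_ ε (List.map x (fibre (i ∷ f) i))                    ∎
  by-cases i₀ i (no i₀≢i) = begin
    lookup (Vec.updateAt G i₀ (x zero ∙_)) i                      ≡⟨ Vec.lookup∘updateAt′ i i₀ (i₀≢i ∘ ≡.sym) G ⟩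
    lookup G i                                                    ≡⟨ lookup-G i ⟩
    foldr _∙_ ε (List.map x (List.map suc (fibre f i)))           ≡⟨ cong (foldr _∙_ ε ∘ List.map x) (fibre-∷-≢ f i₀≢i) ⟨
    foldr _∙_ ε (List.map x (fibre (i₀ ∷ f) i))                   ∎

-- Increasing lists, segments and descents

Increasing : List (Fin m) → Set
Increasing = Linked Fin._<_

allFin-increasing : ∀ q → Increasing (allFin q)
allFin-increasing zero          = []
allFin-increasing (suc zero)    = [-]
allFin-increasing (suc (suc q)) = ℕ.z<s ∷ subst Increasing (List.map-tabulate id suc)
  (Linked.map⁺ (Linked.map ℕ.s<s (allFin-increasing (suc q))))

fibre-increasing : ∀ (f : Vec (Fin p) q) i → Increasing (fibre f i)
fibre-increasing {q = q} f i = Linked.filter⁺ _ Fin.<-trans (allFin-increasing q)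

head-<-tail : ∀ {x k : Fin m} {xs} → Increasing (x ∷ xs) → k ∈ xs → x Fin.< k
head-<-tail (x<y ∷ rest) = All.lookup (Linked.Linked⇒All Fin.<-trans x<y rest)

increasing-≡ : ∀ {xs ys : List (Fin m)} → Increasing xs → Increasing ys →
               (∀ {k} → k ∈ xs → k ∈ ys) → (∀ {k} → k ∈ ys → k ∈ xs) → xs ≡ ys
increasing-≡ {xs = []}     {[]}     _  _  _     _     = refl
increasing-≡ {xs = []}     {y ∷ ys} _  _  _     ys⊆xs with () ← ys⊆xs (here refl)
increasing-≡ {xs = x ∷ xs} {[]}     _  _  xs⊆ys _     with () ← xs⊆ys (here refl)
increasing-≡ {xs = x ∷ xs} {y ∷ ys} ↗xs ↗ys xs⊆ys ys⊆xs = cong₂ _∷_ x≡y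
  (increasing-≡ (Linked.tail ↗xs) (Linked.tail ↗ys) (tail-⊆ ↗xs (≡.sym x≡y) xs⊆ys) (tail-⊆ ↗ys x≡y ys⊆xs))
  where
  x≡y : x ≡ y
  x≡y with xs⊆ys (here refl) | ys⊆xs (here refl)
  ... | here x≡y  | _          = x≡y
  ... | there _   | here y≡x   = ≡.sym y≡x
  ... | there x∈ys | there y∈xs = contradiction (head-<-tail ↗ys x∈ys) (Fin.<-asym (head-<-tail ↗xs y∈xs))
  tail-⊆ : ∀ {a b as bs} → Increasing (a ∷ as) → b ≡ a →
           (∀ {k} → k ∈ a ∷ as → k ∈ b ∷ bs) → ∀ {k} → k ∈ as → k ∈ bs
  tail-⊆ ↗as refl as⊆bs k∈as with as⊆bs (there k∈as)
  ... | here refl = contradiction (head-<-tail ↗as k∈as) (Fin.<-irrefl refl)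
  ... | there k∈bs = k∈bs

fibre-injective : ∀ (f : Vec (Fin q) q) → Injective _≡_ _≡_ (lookup f) →
                  ∀ i → fibre f i ≡ lookup (inverse f) i ∷ []
fibre-injective f f-inj i = increasing-≡ (fibre-increasing f i) [-]
  (λ j∈fibre → here (≡.sym (lookup-inverse f f-inj (∈-fibre⁻ f j∈fibre))))
  (λ { (here refl) → ∈-fibre⁺ f (f∘inverse f f-inj i) })

segments : Vec ℕ p → List A → Vec (List A) p
segments []      l = []
segments (c ∷ γ) l = take c l ∷ segments γ (drop c l)

concatVec : Vec (List A) p → List A
concatVec = List.concat ∘ toList

take-length-++ : ∀ (xs ys : List A) → take (length xs) (xs ++ ys) ≡ xs
take-length-++ []       ys = refl
take-length-++ (x ∷ xs) ys = cong (x ∷_) (take-length-++ xs ys)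

drop-length-++ : ∀ (xs ys : List A) → drop (length xs) (xs ++ ys) ≡ ys
drop-length-++ []       ys = refl
drop-length-++ (x ∷ xs) ys = drop-length-++ xs ys

length-drop-sum : ∀ c (γ : Vec ℕ p) (l : List A) → length l ≡ c ℕ.+ Vec.sum γ → length (drop c l) ≡ Vec.sum γ
length-drop-sum c γ l l≡ = ≡.trans (List.length-drop c l) (≡.trans (cong (_∸ c) l≡) (ℕ.m+n∸m≡n c (Vec.sum γ)))

concat-segments : ∀ (γ : Vec ℕ p) (l : List A) → length l ≡ Vec.sum γ → concatVec (segments γ l) ≡ l
concat-segments []      []  _  = refl
concat-segments (c ∷ γ) l   l≡ =
  ≡.trans (cong (take c l ++_) (concat-segments γ (drop c l) (length-drop-sum c γ l l≡))) (List.take++drop≡id c l)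

lengths-segments : ∀ (γ : Vec ℕ p) (l : List A) → length l ≡ Vec.sum γ → Vec.map length (segments γ l) ≡ γ
lengths-segments []      []  _  = refl
lengths-segments (c ∷ γ) l   l≡ = cong₂ _∷_
  (≡.trans (List.length-take c l) (ℕ.m≤n⇒m⊓n≡m (subst (c ≤_) (≡.sym l≡) (ℕ.m≤m+n c _))))
  (lengths-segments γ (drop c l) (length-drop-sum c γ l l≡))

segments-concat : ∀ (γ : Vec ℕ p) (ls : Vec (List A) p) → Vec.map length ls ≡ γ → segments γ (concatVec ls) ≡ ls
segments-concat []      []       _  = refl
segments-concat (c ∷ γ) (l ∷ ls) eq with refl , eq′ ← Vec.∷-injective eq =
  cong₂ _∷_ (take-length-++ l _) (≡.trans (cong (segments γ) (drop-length-++ l _)) (segments-concat γ ls eq′))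

length-concatVec : ∀ (ls : Vec (List A) p) → length (concatVec ls) ≡ Vec.sum (Vec.map length ls)
length-concatVec []       = refl
length-concatVec (l ∷ ls) = ≡.trans (List.length-++ l) (cong (length l ℕ.+_) (length-concatVec ls))

∈-concatVec⁺ : ∀ {x : A} (ls : Vec (List A) p) i → x ∈ lookup ls i → x ∈ concatVec ls
∈-concatVec⁺ (l ∷ ls) zero    x∈l = ∈.∈-++⁺ˡ x∈l
∈-concatVec⁺ (l ∷ ls) (suc i) x∈ls = ∈.∈-++⁺ʳ l (∈-concatVec⁺ ls i x∈ls)

∈-concatVec⁻ : ∀ {x : A} (ls : Vec (List A) p) → x ∈ concatVec ls → ∃ λ i → x ∈ lookup ls i
∈-concatVec⁻ (l ∷ ls) x∈ with ∈.∈-++⁻ l x∈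
... | inj₁ x∈l  = zero , x∈l
... | inj₂ x∈ls = let i , x∈lsᵢ = ∈-concatVec⁻ ls x∈ls in suc i , x∈lsᵢ

-- Cut i allows a descent between the entries at positions i and i + 1, counting from 0.
DescentsWithin : (ℕ → Set) → List (Fin m) → Set
DescentsWithin Cut []          = ⊤
DescentsWithin Cut (a ∷ [])    = ⊤
DescentsWithin Cut (a ∷ b ∷ l) = (b Fin.< a → Cut 0) × DescentsWithin (Cut ∘ suc) (b ∷ l)

∈⇔any-≡ᵇ : ∀ {x} {S : List ℕ} → x ∈ S ⇔ T (any (λ s → s ℕ.≡ᵇ x) S)
∈⇔any-≡ᵇ {x} = mk⇔ (Any.any⁺ _ ∘ Any.map (λ { refl → ℕ.≡⇒≡ᵇ x x refl }))
                   (Any.map (≡.sym ∘ ℕ.≡ᵇ⇒≡ _ _) ∘ Any.any⁻ _ _)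

T-if-then-else-true : ∀ {c b} → T (if c then b else true) ⇔ (T c → T b)
T-if-then-else-true {true}  = mk⇔ (λ b _ → b) (λ c⇒b → c⇒b _)
T-if-then-else-true {false} = mk⇔ (λ _ ()) _

desIn⇔DescentsWithin : ∀ S k {Cut : ℕ → Set} → (∀ i → Cut i ⇔ k ℕ.+ i ∈ S) →
                       ∀ (l : List (Fin m)) → T (desIn S k l) ⇔ DescentsWithin Cut l
desIn⇔DescentsWithin S k           Cut⇔ []          = mk⇔ _ _
desIn⇔DescentsWithin S k           Cut⇔ (a ∷ [])    = mk⇔ _ _
desIn⇔DescentsWithin S k {Cut} Cut⇔ (a ∷ b ∷ l) =
  ⇔.trans T-∧ (first ×-⇔ desIn⇔DescentsWithin S (suc k) shifted (b ∷ l))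
  where
  ∈-resp-≡ : ∀ {x y} → x ≡ y → x ∈ S ⇔ y ∈ S
  ∈-resp-≡ refl = ⇔.refl
  k∈S⇔Cut0 : T (any (λ s → s ℕ.≡ᵇ k) S) ⇔ Cut 0
  k∈S⇔Cut0 = ⇔.trans (⇔.sym ∈⇔any-≡ᵇ) (⇔.sym (⇔.trans (Cut⇔ 0) (∈-resp-≡ (ℕ.+-identityʳ k))))
  first : T (if toℕ b ℕ.<ᵇ toℕ a then any (λ s → s ℕ.≡ᵇ k) S else true) ⇔ (b Fin.< a → Cut 0)
  first = mk⇔ (λ d b<a → to k∈S⇔Cut0 (to T-if-then-else-true d (ℕ.<⇒<ᵇ b<a)))
              (λ c → from T-if-then-else-true (from k∈S⇔Cut0 ∘ c ∘ ℕ.<ᵇ⇒< _ _))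
  shifted : ∀ i → Cut (suc i) ⇔ suc k ℕ.+ i ∈ S
  shifted i = ⇔.trans (Cut⇔ (suc i)) (∈-resp-≡ (ℕ.+-suc k i))

-- Cut holds at the last position of every block of γ but the final one, and nowhere inside a block.
BlockCuts : Vec ℕ p → (ℕ → Set) → Set
BlockCuts []          Cut = ⊤
BlockCuts (c ∷ [])    Cut = ∀ i → suc i < c → ¬ Cut i
BlockCuts (c ∷ d ∷ γ) Cut = (∀ i → suc i < c → ¬ Cut i) × Cut (c ∸ 1) × BlockCuts (d ∷ γ) (Cut ∘ (c ℕ.+_))

increasing⇒DescentsWithin : ∀ {l : List (Fin m)} → Increasing l → DescentsWithin Cut l
increasing⇒DescentsWithin []          = _
increasing⇒DescentsWithin [-]         = _
increasing⇒DescentsWithin (a<b ∷ ↗l) = (λ b<a → contradiction a<b (Fin.<-asym b<a)) , increasing⇒DescentsWithin ↗l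

DescentsWithin-++⁺ : ∀ {x : Fin m} xs ys → Increasing (x ∷ xs) → Cut (length xs) →
                     DescentsWithin (Cut ∘ (suc (length xs) ℕ.+_)) ys → DescentsWithin Cut (x ∷ xs ++ ys)
DescentsWithin-++⁺ []        []      _           _   _ = _
DescentsWithin-++⁺ []        (y ∷ _) _           cut d = (λ _ → cut) , d
DescentsWithin-++⁺ {Cut = Cut} (x′ ∷ xs) ys (x<x′ ∷ ↗xs) cut d =
  (λ x′<x → contradiction x<x′ (Fin.<-asym x′<x)) , DescentsWithin-++⁺ {Cut = Cut ∘ suc} xs ys ↗xs cut d

distinct-++ʳ : ∀ (xs : List (Fin m)) {ys} → T (distinct (xs ++ ys)) → T (distinct ys)
distinct-++ʳ []       d = d
distinct-++ʳ (x ∷ xs) {ys} d = distinct-++ʳ xs (proj₂ (to (distinct-∷ x (xs ++ ys)) d))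

DescentsWithin-++⁻ : ∀ (xs : List (Fin m)) ys → (∀ i → suc i < length xs → ¬ Cut i) →
                     T (distinct (xs ++ ys)) → DescentsWithin Cut (xs ++ ys) →
                     Increasing xs × DescentsWithin (Cut ∘ (length xs ℕ.+_)) ys
DescentsWithin-++⁻ []            ys       _     _ d = [] , d
DescentsWithin-++⁻ (x ∷ [])      []       _     _ _ = [-] , _
DescentsWithin-++⁻ (x ∷ [])      (y ∷ ys) _     _ d = [-] , proj₂ d
DescentsWithin-++⁻ {Cut = Cut} (x ∷ x′ ∷ xs) ys no-cut d (x′<x⇒cut , d′)
  with ↗xs , rest ← DescentsWithin-++⁻ {Cut = Cut ∘ suc} (x′ ∷ xs) ys (λ i → no-cut (suc i) ∘ s≤s)
                                        (proj₂ (to (distinct-∷ x (x′ ∷ xs ++ ys)) d)) d′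
  = x<x′ ∷ ↗xs , rest
  where
  x<x′ : x Fin.< x′
  x<x′ = Fin.≤∧≢⇒< (ℕ.≮⇒≥ (no-cut 0 (s≤s (s≤s z≤n)) ∘ x′<x⇒cut))
                   (λ { refl → proj₁ (to (distinct-∷ x (x′ ∷ xs ++ ys)) d) (here refl) })

increasing-blocks⇒DescentsWithin : ∀ (ls : Vec (List (Fin m)) p) → VAll.All (λ l → 1 ≤ length l) ls →
  BlockCuts (Vec.map length ls) Cut → (∀ i → Increasing (lookup ls i)) → DescentsWithin Cut (concatVec ls)
increasing-blocks⇒DescentsWithin []                  _              _                 _ = _
increasing-blocks⇒DescentsWithin {Cut = Cut} (l ∷ []) _             _                 ↗ls =
  subst (DescentsWithin Cut) (≡.sym (List.++-identityʳ l)) (increasing⇒DescentsWithin (↗ls zero))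
increasing-blocks⇒DescentsWithin ((x ∷ xs) ∷ l′ ∷ ls) (_ ∷ᵥ nonempty) (_ , cut , cuts) ↗ls =
  DescentsWithin-++⁺ xs _ (↗ls zero) cut (increasing-blocks⇒DescentsWithin (l′ ∷ ls) nonempty cuts (↗ls ∘ suc))

DescentsWithin⇒increasing-blocks : ∀ (ls : Vec (List (Fin m)) p) → BlockCuts (Vec.map length ls) Cut →
  T (distinct (concatVec ls)) → DescentsWithin Cut (concatVec ls) → ∀ i → Increasing (lookup ls i)
DescentsWithin⇒increasing-blocks (l ∷ [])      no-cut       dist d zero    =
  proj₁ (DescentsWithin-++⁻ l [] no-cut dist d)
DescentsWithin⇒increasing-blocks (l ∷ l′ ∷ ls) (no-cut , _) dist d zero    =
  proj₁ (DescentsWithin-++⁻ l _ no-cut dist d)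
DescentsWithin⇒increasing-blocks (l ∷ l′ ∷ ls) (no-cut , _ , cuts) dist d (suc i) =
  DescentsWithin⇒increasing-blocks (l′ ∷ ls) cuts (distinct-++ʳ l dist) (proj₂ (DescentsWithin-++⁻ l _ no-cut dist d)) i

BlockCuts-resp : ∀ (γ : Vec ℕ p) {Cut Cut′ : ℕ → Set} → (∀ i → Cut i ⇔ Cut′ i) →
                 BlockCuts γ Cut → BlockCuts γ Cut′
BlockCuts-resp []          Cut⇔ _                     = _
BlockCuts-resp (c ∷ [])    Cut⇔ no-cut                = λ i i<c → no-cut i i<c ∘ from (Cut⇔ i)
BlockCuts-resp (c ∷ d ∷ γ) Cut⇔ (no-cut , cut , cuts) =
  (λ i i<c → no-cut i i<c ∘ from (Cut⇔ i)) , to (Cut⇔ (c ∸ 1)) cut , BlockCuts-resp (d ∷ γ) (Cut⇔ ∘ (c ℕ.+_)) cuts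

module _ (c d : ℕ) (γ : Vec ℕ k) where

  partialSums-∷ : partialSums (c ∷ d ∷ γ) ≡ c ℕ.+ 0 ∷ List.map (c ℕ.+_) (partialSums (d ∷ γ))
  partialSums-∷ = cong (c ℕ.+ 0 ∷_) (≡.trans (List.map-tabulate suc _) (≡.sym
    (≡.trans (cong (List.map (c ℕ.+_)) (List.map-tabulate id _)) (List.map-tabulate _ (c ℕ.+_)))))

  first-partialSum : c ∈ partialSums (c ∷ d ∷ γ)
  first-partialSum rewrite partialSums-∷ = here (≡.sym (ℕ.+-identityʳ c))

  partialSums-shift : ∀ i → suc (c ℕ.+ i) ∈ partialSums (c ∷ d ∷ γ) ⇔ suc i ∈ partialSums (d ∷ γ)
  partialSums-shift i rewrite partialSums-∷ = mk⇔ shift-to shift-from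
    where
    shift-to : suc (c ℕ.+ i) ∈ c ℕ.+ 0 ∷ List.map (c ℕ.+_) (partialSums (d ∷ γ)) → suc i ∈ partialSums (d ∷ γ)
    shift-to (here eq) = contradiction (≡.trans (ℕ.+-suc c i) (≡.trans eq (ℕ.+-identityʳ c))) (ℕ.m+1+n≢m c)
    shift-to (there m) with s , s∈ , eq ← ∈.∈-map⁻ (c ℕ.+_) m =
      subst (_∈ partialSums (d ∷ γ)) (≡.sym (ℕ.+-cancelˡ-≡ c (suc i) s (≡.trans (ℕ.+-suc c i) eq))) s∈
    shift-from : suc i ∈ partialSums (d ∷ γ) → suc (c ℕ.+ i) ∈ c ℕ.+ 0 ∷ List.map (c ℕ.+_) (partialSums (d ∷ γ))
    shift-from m = there (subst (_∈ List.map (c ℕ.+_) (partialSums (d ∷ γ))) (ℕ.+-suc c i) (∈.∈-map⁺ (c ℕ.+_) m))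

partialSums-≥ : ∀ c (γ : Vec ℕ p) {x} → x ∈ partialSums (c ∷ γ) → c ≤ x
partialSums-≥ c (d ∷ γ) x∈ rewrite partialSums-∷ c d γ with x∈
... | here refl = ℕ.m≤m+n c 0
... | there m with s , _ , refl ← ∈.∈-map⁻ (c ℕ.+_) m = ℕ.m≤m+n c s

partialSums-BlockCuts : ∀ (γ : Vec ℕ p) → VAll.All (1 ≤_) γ → BlockCuts γ (λ i → suc i ∈ partialSums γ)
partialSums-BlockCuts []          _ = _
partialSums-BlockCuts (c ∷ [])    _ = λ _ _ ()
partialSums-BlockCuts (suc c ∷ d ∷ γ) (s≤s z≤n ∷ᵥ positive) =
  (λ i i+1<c i+1∈ → ℕ.<⇒≱ i+1<c (partialSums-≥ (suc c) (d ∷ γ) i+1∈))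
  , first-partialSum (suc c) d γ
  , BlockCuts-resp (d ∷ γ) (⇔.sym ∘ partialSums-shift (suc c) d γ) (partialSums-BlockCuts (d ∷ γ) positive)

distinct-++⇒disjoint : ∀ (xs : List (Fin m)) {ys k} → T (distinct (xs ++ ys)) → k ∈ xs → k ∉ ys
distinct-++⇒disjoint (x ∷ xs) {ys} d (here refl) = proj₁ (to (distinct-∷ x (xs ++ ys)) d) ∘ ∈.∈-++⁺ʳ xs
distinct-++⇒disjoint (x ∷ xs) {ys} d (there k∈)  = distinct-++⇒disjoint xs (proj₂ (to (distinct-∷ x (xs ++ ys)) d)) k∈

distinct-concatVec⇒disjoint : ∀ (ls : Vec (List (Fin m)) p) → T (distinct (concatVec ls)) →
                              ∀ {i j k} → k ∈ lookup ls i → k ∈ lookup ls j → i ≡ j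
distinct-concatVec⇒disjoint (l ∷ ls) d {zero}  {zero}  _    _    = refl
distinct-concatVec⇒disjoint (l ∷ ls) d {zero}  {suc j} k∈l  k∈ls =
  contradiction (∈-concatVec⁺ ls j k∈ls) (distinct-++⇒disjoint l d k∈l)
distinct-concatVec⇒disjoint (l ∷ ls) d {suc i} {zero}  k∈ls k∈l  =
  contradiction (∈-concatVec⁺ ls i k∈ls) (distinct-++⇒disjoint l d k∈l)
distinct-concatVec⇒disjoint (l ∷ ls) d {suc i} {suc j} k∈i  k∈j  =
  cong suc (distinct-concatVec⇒disjoint ls (distinct-++ʳ l d) k∈i k∈j)

-- Tuples of words and unshuffles

single : Fin q → List A → Vec (List A) q
single {q = suc q} zero    u = u ∷ Vec.replicate q []
single             (suc i) u = [] ∷ single i u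

infixr 5 _⊛_
_⊛_ : Vec (List A) q → Vec (List A) q → Vec (List A) q
_⊛_ = Vec.zipWith _++_

⊛-identityˡ : ∀ (ys : Vec (List A) q) → Vec.replicate q [] ⊛ ys ≡ ys
⊛-identityˡ = Vec.zipWith-identityˡ (λ _ → refl)

⊛-identityʳ : ∀ (xs : Vec (List A) q) → xs ⊛ Vec.replicate q [] ≡ xs
⊛-identityʳ = Vec.zipWith-identityʳ List.++-identityʳ

⊛-assoc : ∀ (xs ys zs : Vec (List A) q) → (xs ⊛ ys) ⊛ zs ≡ xs ⊛ (ys ⊛ zs)
⊛-assoc = Vec.zipWith-assoc List.++-assoc

single-⊛-single : ∀ (i : Fin q) (u v : List A) → single i u ⊛ single i v ≡ single i (u ++ v)
single-⊛-single zero    u v = cong ((u ++ v) ∷_) (⊛-identityˡ _)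
single-⊛-single (suc i) u v = cong ([] ∷_) (single-⊛-single i u v)

single-⊛-comm : ∀ {i j : Fin q} (u v : List A) → i ≢ j → single i u ⊛ single j v ≡ single j v ⊛ single i u
single-⊛-comm {i = zero}  {zero}  u v i≢j = ⊥-elim (i≢j refl)
single-⊛-comm {i = zero}  {suc j} u v _   =
  cong₂ _∷_ (List.++-identityʳ u) (≡.trans (⊛-identityˡ _) (≡.sym (⊛-identityʳ _)))
single-⊛-comm {i = suc i} {zero}  u v _   =
  cong₂ _∷_ (≡.sym (List.++-identityʳ v)) (≡.trans (⊛-identityʳ _) (≡.sym (⊛-identityˡ _)))
single-⊛-comm {i = suc i} {suc j} u v i≢j = cong ([] ∷_) (single-⊛-comm u v (i≢j ∘ cong suc))

unshuffle : List (Fin q) → List A → Vec (List A) q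
unshuffle []      _       = Vec.replicate _ []
unshuffle (i ∷ g) []      = Vec.replicate _ []
unshuffle (i ∷ g) (x ∷ u) = single i (x ∷ []) ⊛ unshuffle g u

unshuffle-++ : ∀ (g g′ : List (Fin q)) (u v : List A) → length g ≡ length u →
               unshuffle (g ++ g′) (u ++ v) ≡ unshuffle g u ⊛ unshuffle g′ v
unshuffle-++ []      g′ []      v _     = ≡.sym (⊛-identityˡ _)
unshuffle-++ (i ∷ g) g′ (x ∷ u) v |g|≡|u| =
  ≡.trans (cong (single i (x ∷ []) ⊛_) (unshuffle-++ g g′ u v (ℕ.suc-injective |g|≡|u|))) (≡.sym (⊛-assoc _ _ _))

lookup-single-≡ : ∀ (i : Fin q) (u : List A) → lookup (single i u) i ≡ u
lookup-single-≡ zero    u = refl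
lookup-single-≡ (suc i) u = lookup-single-≡ i u

lookup-single-≢ : ∀ {i j : Fin q} (u : List A) → i ≢ j → lookup (single i u) j ≡ []
lookup-single-≢ {i = zero}  {zero}  u i≢j = ⊥-elim (i≢j refl)
lookup-single-≢ {i = zero}  {suc j} u _   = Vec.lookup-replicate j []
lookup-single-≢ {i = suc i} {zero}  u _   = refl
lookup-single-≢ {i = suc i} {suc j} u i≢j = lookup-single-≢ u (i≢j ∘ cong suc)

lookup-unshuffle : ∀ {k} (g : Vec (Fin q) k) (t : Fin k → A) i →
                   lookup (unshuffle (toList g) (List.tabulate t)) i ≡ List.map t (fibre g i)
lookup-unshuffle []       t i = Vec.lookup-replicate i []
lookup-unshuffle (i₀ ∷ g) t i = begin
  lookup (single i₀ (t zero ∷ []) ⊛ unshuffle (toList g) (List.tabulate (t ∘ suc))) i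
    ≡⟨ Vec.lookup-zipWith _++_ i (single i₀ (t zero ∷ [])) _ ⟩
  lookup (single i₀ (t zero ∷ [])) i ++ lookup (unshuffle (toList g) (List.tabulate (t ∘ suc))) i
    ≡⟨ cong (lookup (single i₀ (t zero ∷ [])) i ++_) (≡.trans (lookup-unshuffle g (t ∘ suc) i) (List.map-∘ (fibre g i))) ⟩
  lookup (single i₀ (t zero ∷ [])) i ++ List.map t (List.map suc (fibre g i))
    ≡⟨ by-cases i₀ i (i₀ Fin.≟ i) ⟩
  List.map t (fibre (i₀ ∷ g) i) ∎
  where
  open ≡.≡-Reasoning
  by-cases : ∀ i₀ i → Dec (i₀ ≡ i) → lookup (single i₀ (t zero ∷ [])) i ++ List.map t (List.map suc (fibre g i))
                                       ≡ List.map t (fibre (i₀ ∷ g) i)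
  by-cases i .i (yes refl) = ≡.trans (cong (_++ List.map t (List.map suc (fibre g i))) (lookup-single-≡ i _))
                                     (cong (List.map t) (≡.sym (fibre-∷-≡ g i)))
  by-cases i₀ i (no i₀≢i)  = ≡.trans (cong (_++ List.map t (List.map suc (fibre g i))) (lookup-single-≢ _ i₀≢i))
                                     (cong (List.map t) (≡.sym (fibre-∷-≢ g i₀≢i)))

-- Shuffles of the blocks of a composition

toVecOr : A → List A → Vec A k
toVecOr {k = zero}  d _        = []
toVecOr {k = suc k} d []       = d ∷ toVecOr d []
toVecOr {k = suc k} d (x ∷ xs) = x ∷ toVecOr d xs

toList-toVecOr : ∀ (d : A) (l : List A) → length l ≡ k → toList (toVecOr {k = k} d l) ≡ l
toList-toVecOr d []       refl = refl
toList-toVecOr d (x ∷ xs) refl = cong (x ∷_) (toList-toVecOr d xs refl)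

toVecOr-toList : ∀ (d : A) (v : Vec A k) → toVecOr d (toList v) ≡ v
toVecOr-toList d []       = refl
toVecOr-toList d (x ∷ v) = cong (x ∷_) (toVecOr-toList d v)

fibres : Vec (Fin p) k → Vec (List (Fin k)) p
fibres g = tabulate (fibre g)

lookup-fibres : ∀ (g : Vec (Fin p) k) i → lookup (fibres g) i ≡ fibre g i
lookup-fibres g = Vec.lookup∘tabulate (fibre g)

-- k₀ and i₀ are junk values: toVecOr pads with k₀ only for lists of the wrong length, and
-- findOr returns i₀ only for values lying in no block.  Both cases lie outside the bijection.
module ShuffleBijection {n p} (γ : Vec ℕ p) (γ-composition : IsComposition n γ) (k₀ : Fin n) (i₀ : Fin p) where

  open DecMembership (Fin._≟_ {n}) using (_∈?_)

  private
    parts-positive : VAll.All (1 ≤_) γ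
    parts-positive = proj₁ γ-composition
    γ-sum : Vec.sum γ ≡ n
    γ-sum = proj₂ γ-composition

  HasFibreSizes : Vec (Fin p) n → Bool
  HasFibreSizes g = isYes (Vec.≡-dec ℕ._≟_ (Vec.map length (fibres g)) γ)

  IsShuffle : Vec (Fin n) n → Bool
  IsShuffle w = distinct (toList w) ∧ desIn (partialSums γ) 1 (toList w)

  concatFibres : Vec (Fin p) n → Vec (Fin n) n
  concatFibres g = toVecOr k₀ (concatVec (fibres g))

  blockIndex : Vec (Fin n) n → Vec (Fin p) n
  blockIndex w = tabulate λ k → findOr i₀ (λ i → k ∈? lookup (segments γ (toList w)) i)

  ∈-segment⇒blockIndex : ∀ w {k i} → (∀ {j} → k ∈ lookup (segments γ (toList w)) j → j ≡ i) →
                         k ∈ lookup (segments γ (toList w)) i → lookup (blockIndex w) k ≡ i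
  ∈-segment⇒blockIndex w {k} unique k∈ =
    ≡.trans (Vec.lookup∘tabulate _ k) (findOr-unique i₀ (λ i → k ∈? lookup (segments γ (toList w)) i) k∈ unique)

  descents⇔ : ∀ (l : List (Fin n)) → T (desIn (partialSums γ) 1 l) ⇔ DescentsWithin (λ i → suc i ∈ partialSums γ) l
  descents⇔ = desIn⇔DescentsWithin (partialSums γ) 1 (λ i → ⇔.refl)

  module _ (g : Vec (Fin p) n) (g-sizes : T (HasFibreSizes g)) where

    fibre-sizes : Vec.map length (fibres g) ≡ γ
    fibre-sizes = toWitness g-sizes

    toList-concatFibres : toList (concatFibres g) ≡ concatVec (fibres g)
    toList-concatFibres = toList-toVecOr k₀ _
      (≡.trans (length-concatVec (fibres g)) (≡.trans (cong Vec.sum fibre-sizes) γ-sum))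

    concatFibres-injective : Injective _≡_ _≡_ (lookup (concatFibres g))
    concatFibres-injective = surjective⇒injective λ k → ∈-toList⇒lookup (concatFibres g)
      (subst (k ∈_) (≡.sym toList-concatFibres) (∈-concatVec⁺ (fibres g) (lookup g k)
        (subst (k ∈_) (≡.sym (lookup-fibres g (lookup g k))) (∈-fibre⁺ g refl))))

    concatFibres-isShuffle : T (IsShuffle (concatFibres g))
    concatFibres-isShuffle = from T-∧
      ( injective⇒distinct (concatFibres g) concatFibres-injective
      , from (descents⇔ _) (subst (DescentsWithin _) (≡.sym toList-concatFibres)
          (increasing-blocks⇒DescentsWithin (fibres g) nonempty cuts increasing)))
      where
      nonempty : VAll.All (λ l → 1 ≤ length l) (fibres g)
      nonempty = VAll.map⁻ (subst (VAll.All (1 ≤_)) (≡.sym fibre-sizes) parts-positive)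
      cuts : BlockCuts (Vec.map length (fibres g)) (λ i → suc i ∈ partialSums γ)
      cuts = subst (λ sizes → BlockCuts sizes _) (≡.sym fibre-sizes) (partialSums-BlockCuts γ parts-positive)
      increasing : ∀ i → Increasing (lookup (fibres g) i)
      increasing i = subst Increasing (≡.sym (lookup-fibres g i)) (fibre-increasing g i)

    blockIndex-concatFibres : blockIndex (concatFibres g) ≡ g
    blockIndex-concatFibres = ≗⇒≡ λ k → ∈-segment⇒blockIndex (concatFibres g) (only-in-own-fibre k) (in-own-fibre k)
      where
      segments≡fibres : segments γ (toList (concatFibres g)) ≡ fibres g
      segments≡fibres = ≡.trans (cong (segments γ) toList-concatFibres) (segments-concat γ (fibres g) fibre-sizes)
      in-own-fibre : ∀ k → k ∈ lookup (segments γ (toList (concatFibres g))) (lookup g k)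
      in-own-fibre k rewrite segments≡fibres | lookup-fibres g (lookup g k) = ∈-fibre⁺ g refl
      only-in-own-fibre : ∀ k {j} → k ∈ lookup (segments γ (toList (concatFibres g))) j → j ≡ lookup g k
      only-in-own-fibre k {j} k∈ rewrite segments≡fibres | lookup-fibres g j = ≡.sym (∈-fibre⁻ g k∈)

  module _ (w : Vec (Fin n) n) (w-shuffle : T (IsShuffle w)) where

    private
      segs : Vec (List (Fin n)) p
      segs = segments γ (toList w)
      w-distinct : T (distinct (toList w))
      w-distinct = proj₁ (to (T-∧ {distinct (toList w)}) w-shuffle)
      w-descents : T (desIn (partialSums γ) 1 (toList w))
      w-descents = proj₂ (to (T-∧ {distinct (toList w)}) w-shuffle)
      length-w : length (toList w) ≡ Vec.sum γ
      length-w = ≡.trans (Vec.length-toList w) (≡.sym γ-sum)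
      concat-segs : concatVec segs ≡ toList w
      concat-segs = concat-segments γ (toList w) length-w
      segment-sizes : Vec.map length segs ≡ γ
      segment-sizes = lengths-segments γ (toList w) length-w
      segs-distinct : T (distinct (concatVec segs))
      segs-distinct = subst (T ∘ distinct) (≡.sym concat-segs) w-distinct

    segments-increasing : ∀ i → Increasing (lookup segs i)
    segments-increasing = DescentsWithin⇒increasing-blocks segs
      (subst (λ sizes → BlockCuts sizes _) (≡.sym segment-sizes) (partialSums-BlockCuts γ parts-positive))
      segs-distinct
      (subst (DescentsWithin _) (≡.sym concat-segs) (to (descents⇔ (toList w)) w-descents))

    in-some-segment : ∀ k → ∃ λ i → k ∈ lookup segs i
    in-some-segment k = let j , wj≡k = injective⇒surjective (distinct⇒injective w w-distinct) k in
      ∈-concatVec⁻ segs (subst (_∈ concatVec segs) wj≡k (subst (lookup w j ∈_) (≡.sym concat-segs) (lookup∈toList w j)))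

    blockIndex-segment : ∀ {k i} → k ∈ lookup segs i → lookup (blockIndex w) k ≡ i
    blockIndex-segment k∈ =
      ∈-segment⇒blockIndex w (λ k∈′ → distinct-concatVec⇒disjoint segs segs-distinct k∈′ k∈) k∈

    fibres-blockIndex : fibres (blockIndex w) ≡ segs
    fibres-blockIndex = ≗⇒≡ λ i → ≡.trans (lookup-fibres (blockIndex w) i)
      (increasing-≡ (fibre-increasing (blockIndex w) i) (segments-increasing i)
        (λ {k} k∈fibre → let i′ , k∈i′ = in-some-segment k in
          subst (λ j → k ∈ lookup segs j)
                (≡.trans (≡.sym (blockIndex-segment k∈i′)) (∈-fibre⁻ (blockIndex w) k∈fibre)) k∈i′)
        (∈-fibre⁺ (blockIndex w) ∘ blockIndex-segment))

    blockIndex-hasFibreSizes : T (HasFibreSizes (blockIndex w))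
    blockIndex-hasFibreSizes = fromWitness (≡.trans (cong (Vec.map length) fibres-blockIndex) segment-sizes)

    concatFibres-blockIndex : concatFibres (blockIndex w) ≡ w
    concatFibres-blockIndex = ≡.trans (cong (toVecOr k₀ ∘ concatVec) fibres-blockIndex)
                                      (≡.trans (cong (toVecOr k₀) concat-segs) (toVecOr-toList k₀ w))

concatVec-map : ∀ {b} {B : Set b} (f : A → B) (ls : Vec (List A) p) →
                concatVec (Vec.map (List.map f) ls) ≡ List.map f (concatVec ls)
concatVec-map f ls = ≡.trans (cong List.concat (Vec.toList-map (List.map f) ls)) (List.concat-map (toList ls))

lengths-map : ∀ {b} {B : Set b} (f : A → B) (ls : Vec (List A) p) →
              Vec.map length (Vec.map (List.map f) ls) ≡ Vec.map length ls
lengths-map f ls = ≡.trans (≡.sym (Vec.map-∘ length (List.map f) ls)) (Vec.map-cong (List.length-map f) ls)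

unshuffle-tabulate : ∀ (g : Vec (Fin p) k) (t : Fin k → A) →
                     unshuffle (toList g) (List.tabulate t) ≡ Vec.map (List.map t) (fibres g)
unshuffle-tabulate g t = ≗⇒≡ λ i → ≡.trans (lookup-unshuffle g t i)
  (≡.sym (≡.trans (Vec.lookup-map i (List.map t) (fibres g)) (cong (List.map t) (lookup-fibres g i))))

tabulate-lookup-cast : ∀ (u : List A) (eq : length u ≡ k) → List.tabulate (List.lookup u ∘ Fin.cast (≡.sym eq)) ≡ u
tabulate-lookup-cast u refl = ≡.trans (List.tabulate-cong (cong (List.lookup u) ∘ Fin.cast-is-id refl)) (List.tabulate-lookup u)

-- Block lengths and arrangements of blocks

filterᵇ-tabulate-suc : ∀ (P : Fin (suc k) → Bool) →
                       filterᵇ P (List.tabulate suc) ≡ List.map suc (filterᵇ (P ∘ suc) (allFin k))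
filterᵇ-tabulate-suc {k = k} P =
  ≡.trans (cong (filterᵇ P) (≡.sym (List.map-tabulate id suc))) (filter-map (T? ∘ P) suc (allFin k))

length-filterᵇ-tabulate-suc : ∀ (P : Fin (suc k) → Bool) →
                              length (filterᵇ P (List.tabulate suc)) ≡ length (filterᵇ (P ∘ suc) (allFin k))
length-filterᵇ-tabulate-suc {k = k} P =
  ≡.trans (cong length (filterᵇ-tabulate-suc P)) (List.length-map suc (filterᵇ (P ∘ suc) (allFin k)))

-- With a split into 0, 1 and ≥ 2 the shifted interval test reduces to the unshifted one.
length-interval : ∀ n a b → b ≤ n → length (filterᵇ (λ j → (a ≤ᵇ toℕ j) ∧ (toℕ j <ᵇ b)) (allFin n)) ≡ b ∸ a
length-interval n       a             zero    _         =
  ≡.trans (cong length (List.filter-none _ (All.universal (λ _ → proj₂ ∘ to T-∧) (allFin n)))) (≡.sym (ℕ.0∸n≡0 a))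
length-interval (suc n) zero          (suc b) (s≤s b≤n) =
  cong suc (≡.trans (length-filterᵇ-tabulate-suc {k = n} (λ j → (zero ≤ᵇ toℕ j) ∧ (toℕ j <ᵇ suc b)))
                    (length-interval n zero b b≤n))
length-interval (suc n) (suc zero)    (suc b) (s≤s b≤n) =
  ≡.trans (length-filterᵇ-tabulate-suc {k = n} (λ j → (1 ≤ᵇ toℕ j) ∧ (toℕ j <ᵇ suc b)))
          (length-interval n zero b b≤n)
length-interval (suc n) (suc (suc a)) (suc b) (s≤s b≤n) =
  ≡.trans (length-filterᵇ-tabulate-suc {k = n} (λ j → (suc (suc a) ≤ᵇ toℕ j) ∧ (toℕ j <ᵇ suc b)))
          (length-interval n (suc a) b b≤n)

psum-suc : ∀ (α : Vec ℕ p) i → psum α (suc (toℕ i)) ≡ psum α (toℕ i) ℕ.+ lookup α i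
psum-suc (c ∷ α) zero    = ℕ.+-comm c 0
psum-suc (c ∷ α) (suc i) = ≡.trans (cong (c ℕ.+_) (psum-suc α i)) (≡.sym (ℕ.+-assoc c _ _))

psum-≤ : ∀ (α : Vec ℕ p) k → psum α k ≤ Vec.sum α
psum-≤ []      zero    = z≤n
psum-≤ []      (suc k) = z≤n
psum-≤ (c ∷ α) zero    = z≤n
psum-≤ (c ∷ α) (suc k) = ℕ.+-monoʳ-≤ c (psum-≤ α k)

length-block : ∀ n (β : Vec ℕ p) → Vec.sum β ≡ n → ∀ i → length (block n β i) ≡ lookup β i
length-block n β β-sum i = begin
  length (block n β i)
    ≡⟨ length-interval n (psum β (toℕ i)) (psum β (suc (toℕ i)))
                         (subst (psum β (suc (toℕ i)) ≤_) β-sum (psum-≤ β (suc (toℕ i)))) ⟩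
  psum β (suc (toℕ i)) ∸ psum β (toℕ i)         ≡⟨ cong (_∸ psum β (toℕ i)) (psum-suc β i) ⟩
  psum β (toℕ i) ℕ.+ lookup β i ∸ psum β (toℕ i) ≡⟨ ℕ.m+n∸m≡n (psum β (toℕ i)) _ ⟩
  lookup β i                                    ∎
  where open ≡.≡-Reasoning

map-lookup-allFin : ∀ (v : Vec A k) → List.map (lookup v) (allFin k) ≡ toList v
map-lookup-allFin []      = refl
map-lookup-allFin (x ∷ v) = cong (x ∷_) (≡.trans (List.map-tabulate suc (lookup (x ∷ v)))
  (≡.trans (≡.sym (List.map-tabulate id (lookup v))) (map-lookup-allFin v)))

sum-lookup-allFin : ∀ (v : Vec ℕ k) → foldr ℕ._+_ 0 (List.map (lookup v) (allFin k)) ≡ Vec.sum v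
sum-lookup-allFin v = ≡.trans (cong (foldr ℕ._+_ 0) (map-lookup-allFin v)) (sum-toList v)
  where
  sum-toList : ∀ {k} (v : Vec ℕ k) → foldr ℕ._+_ 0 (toList v) ≡ Vec.sum v
  sum-toList []      = refl
  sum-toList (x ∷ v) = cong (x ℕ.+_) (sum-toList v)

module Arrangements {n p} (β γ : Vec ℕ p) (γ-composition : IsComposition n γ) where
  open ≡.≡-Reasoning

  fibreWeights : Vec (Fin p) p → Vec ℕ p
  fibreWeights σ = gather ℕ._+_ 0 σ (lookup β)

  HasFibreWeights : Vec (Fin p) p → Bool
  HasFibreWeights σ = isYes (Vec.≡-dec ℕ._≟_ (fibreWeights σ) γ)

  Matches : Vec (Fin p) p → Bool
  Matches χ = all (λ i → lookup β (lookup χ i) ℕ.≡ᵇ lookup γ i) (allFin p)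

  IsArrangement : Vec (Fin p) p → Bool
  IsArrangement χ = distinct (toList χ) ∧ Matches χ

  fibreWeights-injective : ∀ σ → Injective _≡_ _≡_ (lookup σ) →
                           ∀ i → lookup (fibreWeights σ) i ≡ lookup β (lookup (inverse σ) i) ℕ.+ 0
  fibreWeights-injective σ σ-inj i = ≡.trans (lookup-gather ℕ._+_ 0 σ (lookup β) i)
    (cong (foldr ℕ._+_ 0 ∘ List.map (lookup β)) (fibre-injective σ σ-inj i))

  module _ (σ : Vec (Fin p) p) (σ-weights : T (HasFibreWeights σ)) where

    private
      weights≡γ : ∀ i → lookup (fibreWeights σ) i ≡ lookup γ i
      weights≡γ i = cong (λ ws → lookup ws i) (toWitness σ-weights)

    -- Every fibre of σ has positive weight, so σ is onto.
    σ-injective : Injective _≡_ _≡_ (lookup σ)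
    σ-injective = surjective⇒injective λ i → nonempty-fibre (fibre σ i) (∈-fibre⁻ σ) (positive-weight i)
      where
      positive-weight : ∀ i → 1 ≤ foldr ℕ._+_ 0 (List.map (lookup β) (fibre σ i))
      positive-weight i = subst (1 ≤_) (≡.trans (≡.sym (weights≡γ i)) (lookup-gather ℕ._+_ 0 σ (lookup β) i))
                                       (VAll.lookup⁺ (proj₁ γ-composition) i)
      nonempty-fibre : ∀ {i} l → (∀ {j} → j ∈ l → lookup σ j ≡ i) →
                       1 ≤ foldr ℕ._+_ 0 (List.map (lookup β) l) → ∃ λ j → lookup σ j ≡ i
      nonempty-fibre (j ∷ _) in-fibre _ = j , in-fibre (here refl)

    β∘inverse≡γ : ∀ i → lookup β (lookup (inverse σ) i) ≡ lookup γ i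
    β∘inverse≡γ i = begin
      lookup β (lookup (inverse σ) i)          ≡⟨ ℕ.+-identityʳ _ ⟨
      lookup β (lookup (inverse σ) i) ℕ.+ 0    ≡⟨ fibreWeights-injective σ σ-injective i ⟨
      lookup (fibreWeights σ) i                ≡⟨ weights≡γ i ⟩
      lookup γ i                               ∎

    inverse-isArrangement : T (IsArrangement (inverse σ))
    inverse-isArrangement = from T-∧
      ( injective⇒distinct (inverse σ) (inverse-injective σ σ-injective)
      , All.all⁻ _ (All.universal (λ i → ℕ.≡⇒≡ᵇ _ _ (β∘inverse≡γ i)) (allFin p)))

  module _ (χ : Vec (Fin p) p) (χ-arrangement : T (IsArrangement χ)) where

    χ-injective : Injective _≡_ _≡_ (lookup χ)
    χ-injective = distinct⇒injective χ (proj₁ (to (T-∧ {distinct (toList χ)}) χ-arrangement))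

    χ-matches : ∀ i → lookup β (lookup χ i) ≡ lookup γ i
    χ-matches i = ℕ.≡ᵇ⇒≡ _ _ (All.lookup (All.all⁺ _ (allFin p) (proj₂ (to (T-∧ {distinct (toList χ)}) χ-arrangement)))
                                         (∈.∈-allFin i))

    inverse-hasFibreWeights : T (HasFibreWeights (inverse χ))
    inverse-hasFibreWeights = fromWitness (≗⇒≡ λ i → begin
      lookup (fibreWeights (inverse χ)) i
        ≡⟨ fibreWeights-injective (inverse χ) (inverse-injective χ χ-injective) i ⟩
      lookup β (lookup (inverse (inverse χ)) i) ℕ.+ 0
        ≡⟨ cong (λ χ′ → lookup β (lookup χ′ i) ℕ.+ 0) (inverse-involutive χ χ-injective) ⟩
      lookup β (lookup χ i) ℕ.+ 0             ≡⟨ ℕ.+-identityʳ _ ⟩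
      lookup β (lookup χ i)                   ≡⟨ χ-matches i ⟩
      lookup γ i                              ∎)

module Evaluation {c ℓ : Level} (R : CommutativeRing c ℓ) (n : ℕ) where
  open CommutativeRing R renaming (refl to ≈-refl) hiding (zero)
  open import Algebra.Properties.Ring ring using (-‿distribˡ-*)
  open import Algebra.Properties.CommutativeSemigroup *-commutativeSemigroup using (x∙yz≈y∙xz)
  open import Relation.Binary.Reasoning.Setoid setoid
  open FiniteSums R
  open FreeAlg R n

  eval : (Word → Carrier) → Poly → Carrier
  eval h f = ∑[ t ← f ] proj₁ t * h (proj₂ t)

  eval-cong : ∀ f {h h′ : Word → Carrier} → (∀ u → h u ≈ h′ u) → eval h f ≈ eval h′ f
  eval-cong f h≈h′ = ∑-cong f (λ t → *-congˡ (h≈h′ (proj₂ t)))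

  eval-⊕ : ∀ h f g → eval h (f ⊕ g) ≈ eval h f + eval h g
  eval-⊕ h f g = ∑-++ f g _

  eval-⊖ : ∀ h f → eval h (⊖ f) ≈ - eval h f
  eval-⊖ h f = begin
    eval h (⊖ f)                        ≡⟨ ∑-map _ f _ ⟩
    ∑[ t ← f ] (- proj₁ t) * h (proj₂ t) ≈⟨ ∑-cong f (λ t → sym (-‿distribˡ-* _ _)) ⟩
    ∑[ t ← f ] - (proj₁ t * h (proj₂ t)) ≈⟨ -‿∑ f _ ⟨
    - eval h f                          ∎

  eval-⊗ : ∀ h f g → eval h (f ⊗ g) ≈ eval (λ u → eval (λ v → h (u ++ v)) g) f
  eval-⊗ h f g = trans (∑-concatMap _ f _) (∑-cong f λ s → begin
    ∑ (List.map (λ t → (proj₁ s * proj₁ t , proj₂ s ++ proj₂ t)) g) _  ≡⟨ ∑-map _ g _ ⟩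
    ∑[ t ← g ] (proj₁ s * proj₁ t) * h (proj₂ s ++ proj₂ t)           ≈⟨ ∑-cong g (λ t → *-assoc _ _ _) ⟩
    ∑[ t ← g ] proj₁ s * (proj₁ t * h (proj₂ s ++ proj₂ t))           ≈⟨ *-distribˡ-∑ _ g _ ⟨
    proj₁ s * eval (λ v → h (proj₂ s ++ v)) g                         ∎)

  eval-1P : ∀ h → eval h 1P ≈ h []
  eval-1P h = trans (+-identityʳ _) (*-identityˡ _)

  eval-letter : ∀ h i → eval h (letter i) ≈ h (i ∷ [])
  eval-letter h i = trans (+-identityʳ _) (*-identityˡ _)

  eval-ΣP : ∀ {a} {A : Set a} h (F : A → Poly) xs → eval h (ΣP (List.map F xs)) ≈ ∑[ x ← xs ] eval h (F x)
  eval-ΣP h F []       = ≈-refl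
  eval-ΣP h F (x ∷ xs) = trans (eval-⊕ h (F x) _) (+-congˡ (eval-ΣP h F xs))

  eval-act : ∀ h f σ → eval h (act f σ) ≡ eval (h ∘ actWord σ) f
  eval-act h f σ = ∑-map _ f _

  eval-∑ : ∀ {a} {A : Set a} xs (h : A → Word → Carrier) f →
           eval (λ u → ∑[ x ← xs ] h x u) f ≈ ∑[ x ← xs ] eval (h x) f
  eval-∑ xs h f = trans (∑-cong f (λ t → *-distribˡ-∑ _ xs _)) (∑-comm f xs _)

  eval-comm : ∀ (h : Word → Word → Carrier) f g →
              eval (λ u → eval (h u) g) f ≈ eval (λ v → eval (λ u → h u v) f) g
  eval-comm h f g = begin
    ∑[ s ← f ] proj₁ s * (∑[ t ← g ] proj₁ t * h (proj₂ s) (proj₂ t))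
      ≈⟨ eval-∑ g (λ t u → proj₁ t * h u (proj₂ t)) f ⟩
    ∑[ t ← g ] ∑[ s ← f ] proj₁ s * (proj₁ t * h (proj₂ s) (proj₂ t))
      ≈⟨ ∑-cong g (λ t → trans (∑-cong f (λ s → x∙yz≈y∙xz _ _ _)) (sym (*-distribˡ-∑ _ f _))) ⟩
    ∑[ t ← g ] proj₁ t * (∑[ s ← f ] proj₁ s * h (proj₂ s) (proj₂ t))   ∎

  eval-zero : ∀ f {h : Word → Carrier} → (∀ u → h u ≈ 0#) → eval h f ≈ 0#
  eval-zero f h≈0 = ∑-zero f (λ t → trans (*-congˡ (h≈0 (proj₂ t))) (zeroʳ _))

  actWord-tabulate : ∀ u → length u ≡ n →
    ∃ λ (U : Fin n → Fin n) → List.tabulate U ≡ u × ∀ σ → actWord σ u ≡ List.map U (toList σ)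
  actWord-tabulate u |u|≡n with length u ℕ.≟ n
  ... | no  |u|≢n = ⊥-elim (|u|≢n |u|≡n)
  ... | yes eq    = List.lookup u ∘ Fin.cast (≡.sym eq) , tabulate-lookup-cast u eq , λ σ → Vec.toList-map _ σ

  δ : Word → Word → Carrier
  δ w u = [ does (List.≡-dec Fin._≟_ u w) ]· 1#

  coeff≈eval-δ : ∀ w f → coeff w f ≈ eval (δ w) f
  coeff≈eval-δ w []            = ≈-refl
  coeff≈eval-δ w ((a , u) ∷ f) with List.≡-dec Fin._≟_ u w
  ... | yes _ = +-cong (sym (*-identityʳ a)) (coeff≈eval-δ w f)
  ... | no  _ = trans (sym (+-identityˡ _)) (+-cong (sym (zeroʳ a)) (coeff≈eval-δ w f))

  Homogeneous : ℕ → Poly → Set c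
  Homogeneous L = All (λ t → length (proj₂ t) ≡ L)

  eval-cong-homogeneous : ∀ {L f} {h h′ : Word → Carrier} → Homogeneous L f →
                          (∀ u → length u ≡ L → h u ≈ h′ u) → eval h f ≈ eval h′ f
  eval-cong-homogeneous []          h≈h′ = ≈-refl
  eval-cong-homogeneous (|t|≡L ∷ hf) h≈h′ = +-cong (*-congˡ (h≈h′ _ |t|≡L)) (eval-cong-homogeneous hf h≈h′)

  ⊕-homogeneous : ∀ {L f g} → Homogeneous L f → Homogeneous L g → Homogeneous L (f ⊕ g)
  ⊕-homogeneous = All.++⁺

  ⊖-homogeneous : ∀ {L f} → Homogeneous L f → Homogeneous L (⊖ f)
  ⊖-homogeneous = All.map⁺ ∘ All.map id

  ⊗-homogeneous : ∀ {L L′ f g} → Homogeneous L f → Homogeneous L′ g → Homogeneous (L ℕ.+ L′) (f ⊗ g)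
  ⊗-homogeneous hf hg = All.concat⁺ (All.map⁺ (All.map (λ {s} |s|≡L → All.map⁺ (All.map (λ {t} |t|≡L′ →
    ≡.trans (List.length-++ (proj₂ s)) (cong₂ ℕ._+_ |s|≡L |t|≡L′)) hg)) hf))

  1P-homogeneous : Homogeneous 0 1P
  1P-homogeneous = refl ∷ []

  letter-homogeneous : ∀ i → Homogeneous 1 (letter i)
  letter-homogeneous i = refl ∷ []

  homogeneous-resp : ∀ {L L′ f} → L ≡ L′ → Homogeneous L f → Homogeneous L′ f
  homogeneous-resp refl hf = hf

  V-homogeneous : ∀ S → Homogeneous (length S) (V S)
  V-homogeneous []       = []
  V-homogeneous (s ∷ ss) = homogeneous-resp (ℕ.+-comm (length ss) 1) (bracketing ss (letter-homogeneous s))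
    where
    bracketing : ∀ {L acc} ss → Homogeneous L acc →
                 Homogeneous (length ss ℕ.+ L) (List.foldl (λ acc t → ⟦ acc , letter t ⟧) acc ss)
    bracketing         []       h = h
    bracketing {L} (t ∷ ss) h = homogeneous-resp (ℕ.+-suc (length ss) L) (bracketing ss
      (⊕-homogeneous (homogeneous-resp (ℕ.+-comm L 1) (⊗-homogeneous h (letter-homogeneous t)))
                     (⊖-homogeneous (⊗-homogeneous (letter-homogeneous t) h))))

  evalTensor : ∀ {q} → Vec Poly q → (Vec Word q → Carrier) → Carrier
  evalTensor []       K = K []
  evalTensor (f ∷ fs) K = eval (λ u → evalTensor fs (λ us → K (u ∷ us))) f

  evalTensor-cong : ∀ {q} (fs : Vec Poly q) {K K′ : Vec Word q → Carrier} →
                    (∀ us → K us ≈ K′ us) → evalTensor fs K ≈ evalTensor fs K′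
  evalTensor-cong []       K≈K′ = K≈K′ []
  evalTensor-cong (f ∷ fs) K≈K′ = eval-cong f (λ u → evalTensor-cong fs (K≈K′ ∘ (u ∷_)))

  evalTensor-[]· : ∀ {q} (fs : Vec Poly q) b (K : Vec Word q → Carrier) →
                   evalTensor fs (λ us → [ b ]· K us) ≈ [ b ]· evalTensor fs K
  evalTensor-[]· fs true  K = ≈-refl
  evalTensor-[]· fs false K = zero-tensor fs
    where
    zero-tensor : ∀ {q} (fs : Vec Poly q) → evalTensor fs (λ _ → 0#) ≈ 0#
    zero-tensor []       = ≈-refl
    zero-tensor (f ∷ fs) = trans (eval-cong f (λ _ → zero-tensor fs)) (eval-zero f (λ _ → ≈-refl))

  evalTensor-1P : ∀ q K → evalTensor (Vec.replicate q 1P) K ≈ K (Vec.replicate q [])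
  evalTensor-1P zero    K = ≈-refl
  evalTensor-1P (suc q) K =
    trans (eval-1P (λ u → evalTensor (Vec.replicate q 1P) (K ∘ (u ∷_)))) (evalTensor-1P q (K ∘ ([] ∷_)))

  evalTensor-concat : ∀ {q} (fs : Vec Poly q) (h : Word → Carrier) →
                      evalTensor fs (h ∘ List.concat ∘ toList) ≈ eval h (ΠP (toList fs))
  evalTensor-concat []       h = sym (eval-1P h)
  evalTensor-concat (f ∷ fs) h = trans (eval-cong f (λ u → evalTensor-concat fs (h ∘ (u ++_)))) (sym (eval-⊗ h f _))

  evalTensor-cong-homogeneous : ∀ {q} (fs : Vec Poly q) (Ls : Vec ℕ q) →
    (∀ i → Homogeneous (lookup Ls i) (lookup fs i)) → ∀ {K K′ : Vec Word q → Carrier} →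
    (∀ us → Vec.map length us ≡ Ls → K us ≈ K′ us) → evalTensor fs K ≈ evalTensor fs K′
  evalTensor-cong-homogeneous []       []       _     K≈K′ = K≈K′ [] refl
  evalTensor-cong-homogeneous (f ∷ fs) (L ∷ Ls) fs-hom K≈K′ = eval-cong-homogeneous (fs-hom zero) λ u |u|≡L →
    evalTensor-cong-homogeneous fs Ls (fs-hom ∘ suc) (λ us |us|≡Ls → K≈K′ (u ∷ us) (cong₂ _∷_ |u|≡L |us|≡Ls))

  ΠP-homogeneous : ∀ {a} {I : Set a} (f : I → Poly) (deg : I → ℕ) → (∀ j → Homogeneous (deg j) (f j)) →
                   ∀ l → Homogeneous (foldr ℕ._+_ 0 (List.map deg l)) (ΠP (List.map f l))
  ΠP-homogeneous f deg f-hom []      = 1P-homogeneous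
  ΠP-homogeneous f deg f-hom (j ∷ l) = ⊗-homogeneous (f-hom j) (ΠP-homogeneous f deg f-hom l)

  eval-ΠP-cong : ∀ {a} {I : Set a} (f g : I → Poly) → (∀ j h → eval h (f j) ≈ eval h (g j)) →
                 ∀ l h → eval h (ΠP (List.map f l)) ≈ eval h (ΠP (List.map g l))
  eval-ΠP-cong f g f≈g []      h = ≈-refl
  eval-ΠP-cong f g f≈g (j ∷ l) h = begin
    eval h (f j ⊗ ΠP (List.map f l))                            ≈⟨ eval-⊗ h (f j) _ ⟩
    eval (λ u → eval (λ v → h (u ++ v)) (ΠP (List.map f l))) (f j)
      ≈⟨ eval-cong (f j) (λ u → eval-ΠP-cong f g f≈g l _) ⟩
    eval (λ u → eval (λ v → h (u ++ v)) (ΠP (List.map g l))) (f j) ≈⟨ f≈g j _ ⟩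
    eval (λ u → eval (λ v → h (u ++ v)) (ΠP (List.map g l))) (g j) ≈⟨ eval-⊗ h (g j) _ ⟨
    eval h (g j ⊗ ΠP (List.map g l))                            ∎

  eval-⊗-1P : ∀ h f → eval h (f ⊗ 1P) ≈ eval h f
  eval-⊗-1P h f = trans (eval-⊗ h f 1P)
    (eval-cong f (λ u → trans (eval-1P (h ∘ (u ++_))) (reflexive (cong h (List.++-identityʳ u)))))

module Coproduct {c ℓ : Level} (R : CommutativeRing c ℓ) (n p : ℕ) where
  open CommutativeRing R renaming (refl to ≈-refl) hiding (zero)
  open import Relation.Binary.Reasoning.Setoid setoid
  open FiniteSums R
  open FreeAlg R n
  open Evaluation R n

  Tuple : Set
  Tuple = Vec Word p

  -- Δw H u and Δ H f pair the p-fold unshuffle coproducts of u and f with H.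
  Δw : (Tuple → Carrier) → Word → Carrier
  Δw H u = ∑[ g ← allVecs p (length u) ] H (unshuffle (toList g) u)

  Δw-++ : ∀ H u v → Δw H (u ++ v) ≈ Δw (λ x → Δw (λ y → H (x ⊛ y)) v) u
  Δw-++ H u v = begin
    ∑[ g ← allVecs p (length (u ++ v)) ] H (unshuffle (toList g) (u ++ v))
      ≡⟨ cong (λ L → ∑[ g ← allVecs p L ] H (unshuffle (toList g) (u ++ v))) (List.length-++ u) ⟩
    ∑[ g ← allVecs p (length u ℕ.+ length v) ] H (unshuffle (toList g) (u ++ v))
      ≈⟨ ∑-allVecs-+ p (length u) (length v) (λ g → H (unshuffle g (u ++ v))) ⟩
    ∑[ g ← allVecs p (length u) ] ∑[ g′ ← allVecs p (length v) ] H (unshuffle (toList g ++ toList g′) (u ++ v))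
      ≈⟨ ∑-cong (allVecs p (length u)) (λ g → ∑-cong (allVecs p (length v)) (λ g′ →
           reflexive (cong H (unshuffle-++ (toList g) (toList g′) u v (Vec.length-toList g))))) ⟩
    ∑[ g ← allVecs p (length u) ] ∑[ g′ ← allVecs p (length v) ] H (unshuffle (toList g) u ⊛ unshuffle (toList g′) v) ∎

  Δ : (Tuple → Carrier) → Poly → Carrier
  Δ H = eval (Δw H)

  Δ-⊗ : ∀ H f g → Δ H (f ⊗ g) ≈ Δ (λ x → Δ (λ y → H (x ⊛ y)) g) f
  Δ-⊗ H f g = begin
    eval (Δw H) (f ⊗ g)                                  ≈⟨ eval-⊗ (Δw H) f g ⟩
    eval (λ u → eval (λ v → Δw H (u ++ v)) g) f          ≈⟨ eval-cong f (λ u → eval-cong g (Δw-++ H u)) ⟩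
    eval (λ u → eval (λ v → ∑[ g₁ ← allVecs p (length u) ] Δw (λ y → H (unshuffle (toList g₁) u ⊛ y)) v) g) f
      ≈⟨ eval-cong f (λ u → eval-∑ (allVecs p (length u)) (λ g₁ → Δw (λ y → H (unshuffle (toList g₁) u ⊛ y))) g) ⟩
    eval (Δw (λ x → Δ (λ y → H (x ⊛ y)) g)) f            ∎

  shaped : Vec ℕ p → (Word → Carrier) → Tuple → Carrier
  shaped γ h us = [ isYes (Vec.≡-dec ℕ._≟_ (Vec.map length us) γ) ]· h (concatVec us)

  Primitive : Poly → Set (c ⊔ ℓ)
  Primitive f = ∀ H → Δ H f ≈ ∑[ i ← allFin p ] eval (H ∘ single i) f

  0P-primitive : Primitive 0P
  0P-primitive H = sym (∑-zero (allFin p) (λ _ → ≈-refl))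

  letter-primitive : ∀ t → Primitive (letter t)
  letter-primitive t H = begin
    Δ H (letter t)                                       ≈⟨ eval-letter (Δw H) t ⟩
    ∑[ g ← allVecs p 1 ] H (unshuffle (toList g) (t ∷ []))
      ≈⟨ ∑-allVecs-suc p 0 _ ⟩
    ∑[ i ← allFin p ] (H (single i (t ∷ []) ⊛ Vec.replicate p []) + 0#)
      ≈⟨ ∑-cong (allFin p) (λ i → +-congʳ (trans (reflexive (cong H (⊛-identityʳ _))) (sym (*-identityˡ _)))) ⟩
    ∑[ i ← allFin p ] eval (H ∘ single i) (letter t)     ∎

  Δ-⊗-primitive : ∀ f g → Primitive f → Primitive g → ∀ H → Δ H (f ⊗ g) ≈
    ∑[ i ← allFin p ] ∑[ j ← allFin p ] eval (λ u → eval (λ v → H (single i u ⊛ single j v)) g) f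
  Δ-⊗-primitive f g f-prim g-prim H = begin
    Δ H (f ⊗ g)                                                       ≈⟨ Δ-⊗ H f g ⟩
    Δ (λ x → Δ (λ y → H (x ⊛ y)) g) f                                 ≈⟨ f-prim (λ x → Δ (λ y → H (x ⊛ y)) g) ⟩
    ∑[ i ← allFin p ] eval (λ u → Δ (λ y → H (single i u ⊛ y)) g) f
      ≈⟨ ∑-cong (allFin p) (λ i → eval-cong f (λ u → g-prim (λ y → H (single i u ⊛ y)))) ⟩
    ∑[ i ← allFin p ] eval (λ u → ∑[ j ← allFin p ] eval (λ v → H (single i u ⊛ single j v)) g) f
      ≈⟨ ∑-cong (allFin p) (λ i → eval-∑ (allFin p) (λ j u → eval (λ v → H (single i u ⊛ single j v)) g) f) ⟩
    ∑[ i ← allFin p ] ∑[ j ← allFin p ] eval (λ u → eval (λ v → H (single i u ⊛ single j v)) g) f ∎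

  Δ-⊗-primitiveᵒᵖ : ∀ f g → Primitive f → Primitive g → ∀ H → Δ H (g ⊗ f) ≈
    ∑[ i ← allFin p ] ∑[ j ← allFin p ] eval (λ u → eval (λ v → H (single j v ⊛ single i u)) g) f
  Δ-⊗-primitiveᵒᵖ f g f-prim g-prim H = begin
    Δ H (g ⊗ f)  ≈⟨ Δ-⊗-primitive g f g-prim f-prim H ⟩
    ∑[ j ← allFin p ] ∑[ i ← allFin p ] eval (λ v → eval (λ u → H (single j v ⊛ single i u)) f) g
      ≈⟨ ∑-comm (allFin p) (allFin p) _ ⟩
    ∑[ i ← allFin p ] ∑[ j ← allFin p ] eval (λ v → eval (λ u → H (single j v ⊛ single i u)) f) g
      ≈⟨ ∑-cong (allFin p) (λ i → ∑-cong (allFin p) (λ j → eval-comm (λ v u → H (single j v ⊛ single i u)) g f)) ⟩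
    ∑[ i ← allFin p ] ∑[ j ← allFin p ] eval (λ u → eval (λ v → H (single j v ⊛ single i u)) g) f ∎

  eval-single-⟦⟧ : ∀ f g (H : Tuple → Carrier) (i : Fin p) → eval (H ∘ single i) ⟦ f , g ⟧ ≈
    eval (λ u → eval (λ v → H (single i u ⊛ single i v)) g) f
      + - eval (λ u → eval (λ v → H (single i v ⊛ single i u)) g) f
  eval-single-⟦⟧ f g H i = begin
    eval (H ∘ single i) ⟦ f , g ⟧
      ≈⟨ trans (eval-⊕ _ (f ⊗ g) _) (+-cong (eval-⊗ _ f g) (trans (eval-⊖ _ (g ⊗ f)) (-‿cong (eval-⊗ _ g f)))) ⟩
    eval (λ u → eval (λ v → H (single i (u ++ v))) g) f + - eval (λ v → eval (λ u → H (single i (v ++ u))) f) g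
      ≈⟨ +-congˡ (-‿cong (eval-comm (λ v u → H (single i (v ++ u))) g f)) ⟩
    eval (λ u → eval (λ v → H (single i (u ++ v))) g) f + - eval (λ u → eval (λ v → H (single i (v ++ u))) g) f
      ≈⟨ +-cong (eval-cong f (λ u → eval-cong g (λ v → reflexive (cong H (≡.sym (single-⊛-single i u v))))))
                (-‿cong (eval-cong f (λ u → eval-cong g (λ v → reflexive (cong H (≡.sym (single-⊛-single i v u))))))) ⟩
    eval (λ u → eval (λ v → H (single i u ⊛ single i v)) g) f
      + - eval (λ u → eval (λ v → H (single i v ⊛ single i u)) g) f ∎

  ⟦⟧-primitive : ∀ f g → Primitive f → Primitive g → Primitive ⟦ f , g ⟧
  ⟦⟧-primitive f g f-prim g-prim H = begin
    Δ H ⟦ f , g ⟧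
      ≈⟨ trans (eval-⊕ _ (f ⊗ g) _) (+-congˡ (eval-⊖ _ (g ⊗ f))) ⟩
    Δ H (f ⊗ g) + - Δ H (g ⊗ f)
      ≈⟨ +-cong (Δ-⊗-primitive f g f-prim g-prim H) (-‿cong (Δ-⊗-primitiveᵒᵖ f g f-prim g-prim H)) ⟩
    (∑[ i ← allFin p ] ∑[ j ← allFin p ] X i j) + - (∑[ i ← allFin p ] ∑[ j ← allFin p ] Y i j)
      ≈⟨ +-congˡ (trans (-‿∑ (allFin p) _) (∑-cong (allFin p) (λ i → -‿∑ (allFin p) _))) ⟩
    (∑[ i ← allFin p ] ∑[ j ← allFin p ] X i j) + (∑[ i ← allFin p ] ∑[ j ← allFin p ] - Y i j)
      ≈⟨ trans (sym (∑-+ (allFin p) _ _)) (∑-cong (allFin p) (λ i → sym (∑-+ (allFin p) _ _))) ⟩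
    ∑[ i ← allFin p ] ∑[ j ← allFin p ] (X i j + - Y i j)
      ≈⟨ ∑-cong (allFin p) (λ i → ∑-allFin-single _ i (λ j j≢i →
           trans (+-congˡ (-‿cong (sym (X≈Y (j≢i ∘ ≡.sym))))) (-‿inverseʳ _))) ⟩
    ∑[ i ← allFin p ] (X i i + - Y i i)
      ≈⟨ ∑-cong (allFin p) (sym ∘ eval-single-⟦⟧ f g H) ⟩
    ∑[ i ← allFin p ] eval (H ∘ single i) ⟦ f , g ⟧ ∎
    where
    X Y : Fin p → Fin p → Carrier
    X i j = eval (λ u → eval (λ v → H (single i u ⊛ single j v)) g) f
    Y i j = eval (λ u → eval (λ v → H (single j v ⊛ single i u)) g) f
    X≈Y : ∀ {i j} → i ≢ j → X i j ≈ Y i j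
    X≈Y i≢j = eval-cong f (λ u → eval-cong g (λ v → reflexive (cong H (single-⊛-comm u v i≢j))))

  V-primitive : ∀ S → Primitive (V S)
  V-primitive []       = 0P-primitive
  V-primitive (s ∷ ss) = bracketing ss (letter-primitive s)
    where
    bracketing : ∀ {acc} ss → Primitive acc → Primitive (List.foldl (λ acc t → ⟦ acc , letter t ⟧) acc ss)
    bracketing       []       acc-prim = acc-prim
    bracketing {acc} (t ∷ ss) acc-prim = bracketing ss (⟦⟧-primitive acc (letter t) acc-prim (letter-primitive t))

  evalTensor-updateAt : ∀ {q} (i : Fin q) f (fs : Vec Poly q) K →
    evalTensor (Vec.updateAt fs i (f ⊗_)) K ≈ eval (λ u → evalTensor fs (λ us → K (single i u ⊛ us))) f
  evalTensor-updateAt zero    f (g ∷ fs) K = trans (eval-⊗ _ f g) (eval-cong f λ u → eval-cong g λ v →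
    evalTensor-cong fs (λ us → reflexive (cong (λ us′ → K ((u ++ v) ∷ us′)) (≡.sym (⊛-identityˡ us)))))
  evalTensor-updateAt (suc i) f (g ∷ fs) K =
    trans (eval-cong g (λ v → evalTensor-updateAt i f fs (K ∘ (v ∷_))))
          (eval-comm (λ v u → evalTensor fs (λ us → K (v ∷ single i u ⊛ us))) g f)

  Δ-ΠP : ∀ {q} (P : Fin q → Poly) → (∀ j → Primitive (P j)) → ∀ H →
         Δ H (ΠP (List.tabulate P)) ≈ ∑[ σ ← allVecs p q ] evalTensor (gather _⊗_ 1P σ P) H
  Δ-ΠP {zero}  P P-prim H = trans (eval-1P (Δw H)) (+-congʳ (sym (evalTensor-1P p H)))
  Δ-ΠP {suc q} P P-prim H = begin
    Δ H (P zero ⊗ rest)                                                  ≈⟨ Δ-⊗ H (P zero) rest ⟩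
    Δ (λ x → Δ (λ y → H (x ⊛ y)) rest) (P zero)
      ≈⟨ P-prim zero (λ x → Δ (λ y → H (x ⊛ y)) rest) ⟩
    ∑[ i ← allFin p ] eval (λ u → Δ (λ y → H (single i u ⊛ y)) rest) (P zero)
      ≈⟨ ∑-cong (allFin p) (λ i → eval-cong (P zero) (λ u → Δ-ΠP (P ∘ suc) (P-prim ∘ suc) _)) ⟩
    ∑[ i ← allFin p ] eval (λ u → ∑[ σ ← allVecs p q ] evalTensor (slots σ) (λ ys → H (single i u ⊛ ys))) (P zero)
      ≈⟨ ∑-cong (allFin p) (λ i → eval-∑ (allVecs p q) _ (P zero)) ⟩
    ∑[ i ← allFin p ] ∑[ σ ← allVecs p q ] eval (λ u → evalTensor (slots σ) (λ ys → H (single i u ⊛ ys))) (P zero)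
      ≈⟨ ∑-cong (allFin p) (λ i → ∑-cong (allVecs p q) (λ σ → evalTensor-updateAt i (P zero) (slots σ) H)) ⟨
    ∑[ i ← allFin p ] ∑[ σ ← allVecs p q ] evalTensor (gather _⊗_ 1P (i ∷ σ) P) H
      ≈⟨ ∑-allVecs-suc p q _ ⟨
    ∑[ σ ← allVecs p (suc q) ] evalTensor (gather _⊗_ 1P σ P) H ∎
    where
    rest : Poly
    rest = ΠP (List.tabulate (P ∘ suc))
    slots : Vec (Fin p) q → Vec Poly p
    slots σ = gather _⊗_ 1P σ (P ∘ suc)

module Shuffles {c ℓ : Level} (R : CommutativeRing c ℓ) {n p} (γ : Vec ℕ p) (γ-composition : IsComposition n γ)
                (k₀ : Fin n) (i₀ : Fin p) where
  open CommutativeRing R renaming (refl to ≈-refl) hiding (zero)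
  open import Relation.Binary.Reasoning.Setoid setoid
  open FiniteSums R
  open FreeAlg R n
  open Evaluation R n
  open Coproduct R n p
  open ShuffleBijection γ γ-composition k₀ i₀

  module _ (h : Word → Carrier) (u : Word) (|u|≡n : length u ≡ n) where

    private
      U : Fin n → Fin n
      U = proj₁ (actWord-tabulate u |u|≡n)

      unshuffle-u : ∀ (g : Vec (Fin p) n) → unshuffle (toList g) u ≡ Vec.map (List.map U) (fibres g)
      unshuffle-u g = ≡.trans (cong (unshuffle (toList g)) (≡.sym (proj₁ (proj₂ (actWord-tabulate u |u|≡n)))))
                              (unshuffle-tabulate g U)

      concat≈act : ∀ {g : Vec (Fin p) n} → T (HasFibreSizes g) →
                   h (concatVec (unshuffle (toList g) u)) ≈ h (actWord (concatFibres g) u)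
      concat≈act {g} g-sizes = reflexive (cong h (≡.trans (cong concatVec (unshuffle-u g))
        (≡.trans (concatVec-map U (fibres g))
        (≡.trans (cong (List.map U) (≡.sym (toList-concatFibres g g-sizes)))
                 (≡.sym (proj₂ (proj₂ (actWord-tabulate u |u|≡n)) (concatFibres g)))))))

      shaped-unshuffle : ∀ (g : Vec (Fin p) n) → [ HasFibreSizes g ]· h (concatVec (unshuffle (toList g) u)) ≈
                               shaped γ h (unshuffle (toList g) u)
      shaped-unshuffle g = reflexive (cong (λ ls → [ isYes (Vec.≡-dec ℕ._≟_ ls γ) ]· h (concatVec (unshuffle (toList g) u)))
        (≡.sym (≡.trans (cong (Vec.map length) (unshuffle-u g)) (lengths-map U (fibres g)))))

    ∑-shuffles : ∑[ w ← allVecs n n ] [ IsShuffle w ]· h (actWord w u) ≈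
                 ∑[ g ← allVecs p n ] shaped γ h (unshuffle (toList g) u)
    ∑-shuffles = begin
      ∑[ w ← allVecs n n ] [ IsShuffle w ]· h (actWord w u)
        ≈⟨ ∑-reindex (allVecs-enumerates p n) (allVecs-enumerates n n) {P = HasFibreSizes} {Q = IsShuffle}
             concatFibres blockIndex (λ {g} → concatFibres-isShuffle g) (λ {w} → blockIndex-hasFibreSizes w)
             (λ {g} → blockIndex-concatFibres g) (λ {w} → concatFibres-blockIndex w)
             (λ g → h (concatVec (unshuffle (toList g) u))) (λ w → h (actWord w u)) (λ {g} → concat≈act {g}) ⟨
      ∑[ g ← allVecs p n ] [ HasFibreSizes g ]· h (concatVec (unshuffle (toList g) u))
        ≈⟨ ∑-cong (allVecs p n) shaped-unshuffle ⟩
      ∑[ g ← allVecs p n ] shaped γ h (unshuffle (toList g) u) ∎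

    ∑-Bperms≈Δw : ∑[ w ← Bperms γ ] h (actWord w u) ≈ Δw (shaped γ h) u
    ∑-Bperms≈Δw = begin
      ∑[ w ← Bperms γ ] h (actWord w u)
        ≈⟨ trans (∑-filterᵇ _ (perms n) _) (∑-filterᵇ _ (allVecs n n) _) ⟩
      ∑[ w ← allVecs n n ] [ distinct (toList w) ]· [ desIn (partialSums γ) 1 (toList w) ]· h (actWord w u)
        ≈⟨ ∑-cong (allVecs n n) (λ w →
             reflexive ([]·-∧ (distinct (toList w)) (desIn (partialSums γ) 1 (toList w)) (h (actWord w u)))) ⟩
      ∑[ w ← allVecs n n ] [ IsShuffle w ]· h (actWord w u)
        ≈⟨ ∑-shuffles ⟩
      ∑[ g ← allVecs p n ] shaped γ h (unshuffle (toList g) u)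
        ≡⟨ cong (λ k → ∑[ g ← allVecs p k ] shaped γ h (unshuffle (toList g) u)) (≡.sym |u|≡n) ⟩
      Δw (shaped γ h) u ∎

module BlockProducts {c ℓ : Level} (R : CommutativeRing c ℓ) {n p} (β γ : Vec ℕ p)
                     (β-composition : IsComposition n β) (γ-composition : IsComposition n γ) where
  open CommutativeRing R renaming (refl to ≈-refl) hiding (zero)
  open import Relation.Binary.Reasoning.Setoid setoid
  open FiniteSums R
  open FreeAlg R n
  open Evaluation R n
  open Coproduct R n p
  open Arrangements β γ γ-composition

  P : Fin p → Poly
  P j = V (block n β j)

  P-homogeneous : ∀ j → Homogeneous (lookup β j) (P j)
  P-homogeneous j = homogeneous-resp (length-block n β (proj₂ β-composition) j) (V-homogeneous (block n β j))

  𝐕-homogeneous : Homogeneous n (𝐕 β)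
  𝐕-homogeneous = homogeneous-resp (≡.trans (sum-lookup-allFin β) (proj₂ β-composition))
                                   (ΠP-homogeneous P (lookup β) P-homogeneous (allFin p))

  blockTensor : Vec (Fin p) p → Vec Poly p
  blockTensor σ = gather _⊗_ 1P σ P

  slot-homogeneous : ∀ σ i → Homogeneous (lookup (fibreWeights σ) i) (lookup (blockTensor σ) i)
  slot-homogeneous σ i =
    ≡.subst₂ Homogeneous (≡.sym (lookup-gather ℕ._+_ 0 σ (lookup β) i)) (≡.sym (lookup-gather _⊗_ 1P σ P i))
    (ΠP-homogeneous P (lookup β) P-homogeneous (fibre σ i))

  evalTensor-slots : ∀ σ h → evalTensor (blockTensor σ) (shaped γ h) ≈
                             [ HasFibreWeights σ ]· eval h (ΠP (toList (blockTensor σ)))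
  evalTensor-slots σ h = begin
    evalTensor (blockTensor σ) (shaped γ h)
      ≈⟨ evalTensor-cong-homogeneous (blockTensor σ) (fibreWeights σ) (slot-homogeneous σ)
           (λ us us-sizes → reflexive (cong (λ s → [ isYes (Vec.≡-dec ℕ._≟_ s γ) ]· h (concatVec us)) us-sizes)) ⟩
    evalTensor (blockTensor σ) (λ us → [ HasFibreWeights σ ]· h (concatVec us))
      ≈⟨ evalTensor-[]· (blockTensor σ) (HasFibreWeights σ) (h ∘ concatVec) ⟩
    [ HasFibreWeights σ ]· evalTensor (blockTensor σ) (h ∘ concatVec)
      ≈⟨ []·-cong (HasFibreWeights σ) (evalTensor-concat (blockTensor σ) h) ⟩
    [ HasFibreWeights σ ]· eval h (ΠP (toList (blockTensor σ))) ∎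

  module _ (σ : Vec (Fin p) p) (σ-weights : T (HasFibreWeights σ)) where

    blockTensor-inverse : ∀ h → eval h (ΠP (toList (blockTensor σ))) ≈
                          eval h (ΠP (List.map (P ∘ lookup (inverse σ)) (allFin p)))
    blockTensor-inverse h = trans (reflexive (cong (eval h ∘ ΠP) (≡.sym (map-lookup-allFin (blockTensor σ)))))
      (eval-ΠP-cong (lookup (blockTensor σ)) (P ∘ lookup (inverse σ)) slot≈ (allFin p) h)
      where
      slot≈ : ∀ i h → eval h (lookup (blockTensor σ) i) ≈ eval h (P (lookup (inverse σ) i))
      slot≈ i h = trans (reflexive (cong (eval h) (≡.trans (lookup-gather _⊗_ 1P σ P i)
                    (cong (foldr _⊗_ 1P ∘ List.map P) (fibre-injective σ (σ-injective σ σ-weights) i)))))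
                  (eval-⊗-1P h (P (lookup (inverse σ) i)))

  ∑-arrangements : ∀ h → ∑[ σ ← allVecs p p ] [ HasFibreWeights σ ]· eval h (ΠP (toList (blockTensor σ)))
                         ≈ ∑[ χ ← allVecs p p ] [ IsArrangement χ ]· eval h (ΠP (List.map (P ∘ lookup χ) (allFin p)))
  ∑-arrangements h = ∑-reindex (allVecs-enumerates p p) (allVecs-enumerates p p) {P = HasFibreWeights} {Q = IsArrangement}
    inverse inverse (λ {σ} → inverse-isArrangement σ) (λ {χ} → inverse-hasFibreWeights χ)
    (λ {σ} σ-weights → inverse-involutive σ (σ-injective σ σ-weights))
    (λ {χ} χ-arrangement → inverse-involutive χ (χ-injective χ χ-arrangement))
    (λ σ → eval h (ΠP (toList (blockTensor σ)))) (λ χ → eval h (ΠP (List.map (P ∘ lookup χ) (allFin p))))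
    (λ {σ} σ-weights → blockTensor-inverse σ σ-weights h)

module Pairing {c ℓ : Level} (R : CommutativeRing c ℓ) {n p} (β γ : Vec ℕ p)
               (β-composition : IsComposition n β) (γ-composition : IsComposition n γ) (k₀ : Fin n) (i₀ : Fin p) where
  open CommutativeRing R renaming (refl to ≈-refl) hiding (zero)
  open import Relation.Binary.Reasoning.Setoid setoid
  open FiniteSums R
  open FreeAlg R n
  open Evaluation R n
  open Coproduct R n p
  open Shuffles R γ γ-composition k₀ i₀
  open Arrangements β γ γ-composition
  open BlockProducts R β γ β-composition γ-composition

  eval-actSum≈eval-rhs : ∀ h → eval h (actSum (𝐕 β) (Bperms γ)) ≈ eval h (rhs β γ)
  eval-actSum≈eval-rhs h = begin
    eval h (actSum (𝐕 β) (Bperms γ))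
      ≈⟨ eval-ΣP h (act (𝐕 β)) (Bperms γ) ⟩
    ∑[ w ← Bperms γ ] eval h (act (𝐕 β) w)
      ≈⟨ ∑-cong (Bperms γ) (λ w → reflexive (eval-act h (𝐕 β) w)) ⟩
    ∑[ w ← Bperms γ ] eval (h ∘ actWord w) (𝐕 β)
      ≈⟨ eval-∑ (Bperms γ) (λ w → h ∘ actWord w) (𝐕 β) ⟨
    eval (λ u → ∑[ w ← Bperms γ ] h (actWord w u)) (𝐕 β)
      ≈⟨ eval-cong-homogeneous 𝐕-homogeneous (∑-Bperms≈Δw h) ⟩
    Δ (shaped γ h) (𝐕 β)
      ≡⟨ cong (Δ (shaped γ h) ∘ ΠP) (List.map-tabulate id P) ⟩
    Δ (shaped γ h) (ΠP (List.tabulate P))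
      ≈⟨ Δ-ΠP P (V-primitive ∘ block n β) (shaped γ h) ⟩
    ∑[ σ ← allVecs p p ] evalTensor (blockTensor σ) (shaped γ h)
      ≈⟨ ∑-cong (allVecs p p) (λ σ → evalTensor-slots σ h) ⟩
    ∑[ σ ← allVecs p p ] [ HasFibreWeights σ ]· eval h (ΠP (toList (blockTensor σ)))
      ≈⟨ ∑-arrangements h ⟩
    ∑[ χ ← allVecs p p ] [ IsArrangement χ ]· eval h (ΠP (List.map (P ∘ lookup χ) (allFin p)))
      ≈⟨ ∑-cong (allVecs p p) (λ χ → reflexive ([]·-∧ (distinct (toList χ)) (Matches χ) _)) ⟨
    ∑[ χ ← allVecs p p ] [ distinct (toList χ) ]· [ Matches χ ]· eval h (ΠP (List.map (P ∘ lookup χ) (allFin p)))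
      ≈⟨ trans (∑-filterᵇ Matches (perms p) _) (∑-filterᵇ (distinct ∘ toList) (allVecs p p) _) ⟨
    ∑[ χ ← filterᵇ Matches (perms p) ] eval h (ΠP (List.map (P ∘ lookup χ) (allFin p)))
      ≈⟨ eval-ΣP h (λ χ → ΠP (List.map (P ∘ lookup χ) (allFin p))) (filterᵇ Matches (perms p)) ⟨
    eval h (rhs β γ) ∎

lemma5p1 : ∀ {c ℓ : Level} (R : CommutativeRing c ℓ) (n : ℕ) → 1 ≤ n →
    (p : ℕ) (β γ : Vec ℕ p) → IsComposition n β → IsComposition n γ →
    FreeAlg._≈ₙ_ R n (FreeAlg.actSum R n (FreeAlg.𝐕 R n β) (FreeAlg.Bperms R n γ)) (FreeAlg.rhs R n β γ)
lemma5p1 R (suc n) (s≤s z≤n) zero    [] [] _ (_ , ())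
lemma5p1 R (suc n) (s≤s z≤n) (suc p) β γ β-composition γ-composition w = begin
  coeff (toList w) (actSum (𝐕 β) (Bperms γ))         ≈⟨ coeff≈eval-δ (toList w) (actSum (𝐕 β) (Bperms γ)) ⟩
  eval (δ (toList w)) (actSum (𝐕 β) (Bperms γ))      ≈⟨ eval-actSum≈eval-rhs (δ (toList w)) ⟩
  eval (δ (toList w)) (rhs β γ)                       ≈⟨ coeff≈eval-δ (toList w) (rhs β γ) ⟨
  coeff (toList w) (rhs β γ)                          ∎
  where
  open CommutativeRing R using (setoid)
  open import Relation.Binary.Reasoning.Setoid setoid
  open FreeAlg R (suc n)
  open Evaluation R (suc n)
  open Pairing R β γ β-composition γ-composition zero zero
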